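{- For every connected hypergraph $G$ and every hypergraph $H$, $$\mathsf{InHom}(G,H)=\sum_{G'}\mathsf{LoMeHom}(G,G')\cdot\mathsf{Aut}(G')^{ -1}\cdot\mathsf{LoInjInHom}(G',H),$$ where $G'$ ranges over a fixed set of representatives of the isomorphism classes of connected hypergraphs (the sum having only finitely many non-zero terms). Moreover, the matrix $\mathsf{LoMeHom}$, indexed by these representatives ordered by $|V|+|E|$ (ties broken arbitrarily), is lower triangular and invertible.
   Context: All structures are finite. A hypergraph is a triple $G=(V,E,f)$ with vertex set $V(G)$, edge set $E(G)$ and incidence function $f_G\colon E(G)\to\mathcal{P}(V(G))\setminus\{\emptyset\}$; parallel edges are allowed. $G$ is connected if its incidence graph (bipartite graph on $V(G)\,\dot\cup\,E(G)$ with edges $ve$ for $v\in f_G(e)$) is connected. An incidence homomorphism from $G$ to $H$ is a pair $(h_V,h_E)$, $h_V\colon V(G)\to V(H)$, $h_E\colon E(G)\to E(H)$, with $h_V(f_G(e))\subseteq f_H(h_E(e))$ for all $e$; it is a homomorphism if equality holds for all $e$. It is locally injective if for each $e\in E(G)$ the restriction of $h_V$ to $f_G(e)$ is injective. $\mathsf{InHom}(G,H)$ and $\mathsf{LoInjInHom}(G,H)$ count incidence homomorphisms and locally injective incidence homomorphisms from $G$ to $H$. For an incidence homomorphism $(h_V,h_E)$ define $u\sim_{h_V} v$ for $u,v\in V(G)$ if there is a walk $v_0=u,e_1,v_1,\dots,e_k,v_k=v$ in $G$ (with $v_{i-1},v_i\in f_G(e_i)$) such that $h_V(v_{i-1})=h_V(v_i)$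 for all $i\in\{1,\dots,k\}$. A homomorphism $(h_V,h_E)$ from $G$ to $H$ is locally merging if (i) $h_V(u)=h_V(v)\iff u\sim_{h_V}v$ for all $u,v\in V(G)$, (ii) $h_V$ is surjective, (iii) $h_E$ is bijective; $\mathsf{LoMeHom}(G,H)$ is their number for connected $G,H$. $\mathsf{Aut}(G')$ is the number of automorphisms of $G'$. An infinite matrix $A$ indexed by an ordered set is lower triangular if $A_{ij}=0$ whenever $j\not\le i$; invertible means it has an inverse (a lower triangular matrix with non-zero diagonal entries has one, computed by forward substitution). -}

module Defs where

open import Data.Nat using (ℕ; zero; suc; _+_; _∸_)
open import Data.Fin using (Fin; zero; suc; _≟_)
open import Data.Fin.Properties using (all?; any?)
open import Data.Fin.Subset using (Subset; _∈_; Nonempty)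
open import Data.Fin.Subset.Properties using (_∈?_)
open import Data.List using (List; []; _∷_; map; concatMap; length; filter; cartesianProduct; foldr; lookup; allFin; upTo)
open import Data.Product using (Σ; ∃; _×_; _,_; proj₁; proj₂)
open import Data.Sum using (_⊎_; inj₁; inj₂)
open import Data.Empty using (⊥)
open import Data.Integer using (+_)
open import Data.Rational using (ℚ; _/_; 0ℚ) renaming (_+_ to _+ℚ_; _*_ to _*ℚ_)
open import Relation.Nullary using (Dec; yes; no; ¬_)
open import Relation.Nullary.Decidable using (_×-dec_; _⊎-dec_; _→-dec_)
open import Relation.Binary.PropositionalEquality using (_≡_)
open import Relation.Binary.Construct.Closure.ReflexiveTransitive using (Star)

-- Hypergraphs: vertex set Fin nV, edge set Fin nE (parallel edges allowed),
-- incidence function f : E → nonempty subsets of V.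

record Hypergraph : Set where
  constructor hypergraph
  field
    nV  : ℕ
    nE  : ℕ
    inc : Fin nE → Subset nV
    inc-nonempty : ∀ e → Nonempty (inc e)

open Hypergraph public

V : Hypergraph → Set
V G = Fin (nV G)

E : Hypergraph → Set
E G = Fin (nE G)

-- Connectivity: the incidence graph (bipartite on V ⊎ E) is connected
-- (convention: a connected graph is nonempty).

Node : Hypergraph → Set
Node G = V G ⊎ E G

IAdj : (G : Hypergraph) → Node G → Node G → Set
IAdj G (inj₁ v) (inj₂ e) = v ∈ inc G e
IAdj G (inj₂ e) (inj₁ v) = v ∈ inc G e
IAdj G (inj₁ _) (inj₁ _) = ⊥
IAdj G (inj₂ _) (inj₂ _) = ⊥

Connected : Hypergraph → Set
Connected G = Node G × (∀ x y → Star (IAdj G) x y)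

Injective : ∀ {n k} → (Fin n → Fin k) → Set
Injective h = ∀ u v → h u ≡ h v → u ≡ v

Surjective : ∀ {n k} → (Fin n → Fin k) → Set
Surjective h = ∀ w → ∃ λ v → h v ≡ w

Bijective : ∀ {n k} → (Fin n → Fin k) → Set
Bijective h = Injective h × Surjective h

injective? : ∀ {n k} (h : Fin n → Fin k) → Dec (Injective h)
injective? h = all? λ u → all? λ v → (h u ≟ h v) →-dec (u ≟ v)

surjective? : ∀ {n k} (h : Fin n → Fin k) → Dec (Surjective h)
surjective? h = all? λ w → any? λ v → h v ≟ w

bijective? : ∀ {n k} (h : Fin n → Fin k) → Dec (Bijective h)
bijective? h = injective? h ×-dec surjective? h

IsInHom : (G H : Hypergraph) → (V G → V H) → (E G → E H) → Set
IsInHom G H hV hE = ∀ e v → v ∈ inc G e → hV v ∈ inc H (hE e)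

IsHom : (G H : Hypergraph) → (V G → V H) → (E G → E H) → Set
IsHom G H hV hE = IsInHom G H hV hE
  × (∀ e w → w ∈ inc H (hE e) → ∃ λ v → v ∈ inc G e × hV v ≡ w)

IsLocInj : (G H : Hypergraph) → (V G → V H) → Set
IsLocInj G H hV = ∀ e u v → u ∈ inc G e → v ∈ inc G e → hV u ≡ hV v → u ≡ v

Reach : (G : Hypergraph) {k : ℕ} → (V G → Fin k) → ℕ → V G → V G → Set
Reach G hV zero    u w = u ≡ w
Reach G hV (suc t) u w = Reach G hV t u w
  ⊎ (∃ λ v → ∃ λ e → Reach G hV t u v × v ∈ inc G e × w ∈ inc G e × hV v ≡ hV w)

-- u ~_{h_V} w.  A walk can always be shortened to one with at most
-- |V(G)| edges, so bounding the length by nV G is no restriction.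
Sim : (G : Hypergraph) {k : ℕ} → (V G → Fin k) → V G → V G → Set
Sim G hV u w = Reach G hV (nV G) u w

IsLoMe : (G H : Hypergraph) → (V G → V H) → (E G → E H) → Set
IsLoMe G H hV hE = IsHom G H hV hE
  × (∀ u v → (hV u ≡ hV v → Sim G hV u v) × (Sim G hV u v → hV u ≡ hV v))
  × Surjective hV
  × Bijective hE

IsIso : (G H : Hypergraph) → (V G → V H) → (E G → E H) → Set
IsIso G H hV hE = IsHom G H hV hE × Bijective hV × Bijective hE

Isomorphic : Hypergraph → Hypergraph → Set
Isomorphic G H = Σ (V G → V H) λ hV → Σ (E G → E H) λ hE → IsIso G H hV hE

isInHom? : ∀ G H hV hE → Dec (IsInHom G H hV hE)
isInHom? G H hV hE = all? λ e → all? λ v → (v ∈? inc G e) →-dec (hV v ∈? inc H (hE e))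

isHom? : ∀ G H hV hE → Dec (IsHom G H hV hE)
isHom? G H hV hE = isInHom? G H hV hE ×-dec
  (all? λ e → all? λ w → (w ∈? inc H (hE e)) →-dec
     (any? λ v → (v ∈? inc G e) ×-dec (hV v ≟ w)))

isLocInj? : ∀ G H hV → Dec (IsLocInj G H hV)
isLocInj? G H hV = all? λ e → all? λ u → all? λ v →
  (u ∈? inc G e) →-dec ((v ∈? inc G e) →-dec ((hV u ≟ hV v) →-dec (u ≟ v)))

reach? : ∀ G {k} (hV : V G → Fin k) t u w → Dec (Reach G hV t u w)
reach? G hV zero    u w = u ≟ w
reach? G hV (suc t) u w = reach? G hV t u w ⊎-dec
  (any? λ v → any? λ e → reach? G hV t u v ×-dec ((v ∈? inc G e) ×-dec
     ((w ∈? inc G e) ×-dec (hV v ≟ hV w))))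

isLoMe? : ∀ G H hV hE → Dec (IsLoMe G H hV hE)
isLoMe? G H hV hE = isHom? G H hV hE ×-dec
  ((all? λ u → all? λ v →
     ((hV u ≟ hV v) →-dec reach? G hV (nV G) u v) ×-dec
     (reach? G hV (nV G) u v →-dec (hV u ≟ hV v)))
  ×-dec (surjective? hV ×-dec bijective? hE))

isIso? : ∀ G H hV hE → Dec (IsIso G H hV hE)
isIso? G H hV hE = isHom? G H hV hE ×-dec (bijective? hV ×-dec bijective? hE)

cons : ∀ {n k} → Fin k → (Fin n → Fin k) → Fin (suc n) → Fin k
cons i f zero    = i
cons i f (suc x) = f x

funs : (n k : ℕ) → List (Fin n → Fin k)
funs zero    k = (λ ()) ∷ []
funs (suc n) k = concatMap (λ f → map (λ i → cons i f) (allFin k)) (funs n k)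

countPairs : (G H : Hypergraph) (P : (V G → V H) → (E G → E H) → Set)
  → (∀ hV hE → Dec (P hV hE)) → ℕ
countPairs G H P P? =
  length (filter (λ p → P? (proj₁ p) (proj₂ p))
                 (cartesianProduct (funs (nV G) (nV H)) (funs (nE G) (nE H))))

InHom : Hypergraph → Hypergraph → ℕ
InHom G H = countPairs G H (IsInHom G H) (isInHom? G H)

LoInjInHom : Hypergraph → Hypergraph → ℕ
LoInjInHom G H = countPairs G H (λ hV hE → IsInHom G H hV hE × IsLocInj G H hV)
  (λ hV hE → isInHom? G H hV hE ×-dec isLocInj? G H hV)

LoMeHom : Hypergraph → Hypergraph → ℕ
LoMeHom G H = countPairs G H (IsLoMe G H) (isLoMe? G H)

Aut : Hypergraph → ℕ
Aut G = countPairs G G (IsIso G G) (isIso? G G)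

toℚ : ℕ → ℚ
toℚ n = + n / 1

-- 1/n (only applied to Aut G' ≥ 1; the value at 0 is irrelevant)
inv : ℕ → ℚ
inv zero    = 0ℚ
inv (suc k) = + 1 / suc k

sumℚ : List ℚ → ℚ
sumℚ = foldr _+ℚ_ 0ℚ

record RepSystem : Set where
  field
    reps : ℕ → ℕ → List Hypergraph

  Idx : Set
  Idx = Σ ℕ λ n → Σ ℕ λ m → Fin (length (reps n m))

  rep : Idx → Hypergraph
  rep (n , m , i) = lookup (reps n m) i

  size : Idx → ℕ
  size (n , m , _) = n + m

  field
    rep-nV      : ∀ n m i → nV (rep (n , m , i)) ≡ n
    rep-nE      : ∀ n m i → nE (rep (n , m , i)) ≡ m
    rep-conn    : ∀ a → Connected (rep a)
    rep-distinct : ∀ a b → Isomorphic (rep a) (rep b) → a ≡ b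
    rep-complete : ∀ G → Connected G → ∃ λ a → Isomorphic G (rep a)

  idxUpTo : ℕ → List Idx
  idxUpTo B = concatMap (λ n → concatMap (λ m →
      map (λ i → (n , m , i)) (allFin (length (reps n m))))
    (upTo (suc (B ∸ n)))) (upTo (suc B))

  sumUpTo : ℕ → (Idx → ℚ) → ℚ
  sumUpTo B f = sumℚ (map f (idxUpTo B))

  LoMeMat : Idx → Idx → ℚ
  LoMeMat a b = toℚ (LoMeHom (rep a) (rep b))

LowerTriangular : {I : Set} → (I → I → Set) → (I → I → ℚ) → Set
LowerTriangular _≼_ A = ∀ i j → ¬ (j ≼ i) → A i j ≡ 0ℚ

IsIdentity : {I : Set} → (I → I → ℚ) → Set
IsIdentity A = ∀ i k → (i ≡ k → A i k ≡ toℚ 1) × (¬ (i ≡ k) → A i k ≡ 0ℚ)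

-- An incidence homomorphism φ : G → H from a connected G factors as a locally merging
-- σ : G → X followed by a locally injective τ : X → H, with X the quotient of G by ∼_φ; for every such
-- factorisation the kernel of σ is exactly ∼_φ, so X is unique up to isomorphism. Hence φ factors
-- through exactly one representative G′, and Aut(G′) acts simply transitively on the factorisations
-- through G′: LoMeHom(G,G′) · LoInjInHom(G′,H) = Aut(G′) · #{φ factoring through G′}, and summing over
-- G′ counts InHom(G,H). A locally merging map is onto on vertices and bijective on edges, so
-- LoMeHom(G′,G″) vanishes unless G′ = G″ or |V(G″)| + |E(G″)| < |V(G′)| + |E(G′)|, while the identity
-- makes the diagonal non-zero; the matrix is therefore inverted by forward substitution.

module Submission where

open import Defs
open import Algebra.Structures using (IsCommutativeSemiring; IsCommutativeRing)
open import Data.Bool using (true)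
open import Data.Empty using (⊥-elim)
open import Data.Fin using (Fin; zero; suc; punchOut)
import Data.Fin as Fin
import Data.Fin.Properties as FinP
open import Data.Fin.Subset using (Subset; _∈_)
open import Data.Fin.Subset.Properties using (_∈?_)
open import Data.Integer using (+_)
import Data.Integer as ℤ
import Data.Integer.Properties as ℤP
open import Data.List
  using (List; []; _∷_; [_]; _++_; _∷ʳ_; map; concat; concatMap; length; filter; allFin; tabulate; upTo; cartesianProduct)
import Data.List.Properties as ListP
open import Data.List.Membership.Propositional using () renaming (_∈_ to _∈ˡ_)
open import Data.List.Membership.Propositional.Properties using (∈-allFin)
open import Data.List.Relation.Unary.Any using (here; there)
open import Data.Nat using (ℕ; zero; suc; _+_; _*_; _∸_; _≤_; _<_; z≤n; s≤s; _≤?_; _<?_)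
import Data.Nat as ℕ
open import Data.Nat.Coprimality using (Coprime; 1-coprimeTo) renaming (sym to coprime-sym)
import Data.Nat.Induction as ℕInd
import Data.Nat.Properties as ℕP
open import Data.Product using (∃; _×_; _,_; proj₁; proj₂)
import Data.Product.Properties as ProductP
open import Data.Product.Relation.Binary.Pointwise.NonDependent using (×-decSetoid)
open import Data.Rational using (ℚ; mkℚ; 0ℚ; 1ℚ; 1/_; _-_; -_) renaming (_+_ to _+ℚ_; _*_ to _*ℚ_)
import Data.Rational.Properties as ℚP
open import Data.Rational.Solver using (module +-*-Solver)
open import Data.Sum using (_⊎_; inj₁; inj₂; [_,_]′)
import Data.Vec as Vec
import Data.Vec.Properties as VecP
open import Function using (_∘_; _on_)
open import Induction.WellFounded using (WfRec; module All; module FixPoint)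
open import Level using (0ℓ)
open import Relation.Nullary using (Dec; yes; no; does; ¬_; ¬?)
open import Relation.Nullary.Decidable using (_×-dec_; _→-dec_; map′; decidable-stable)
open import Relation.Unary using (Pred; Decidable)
open import Relation.Binary.Bundles using (DecSetoid)
open import Relation.Binary.Core using (Rel)
open import Relation.Binary.Construct.Closure.ReflexiveTransitive using (Star; gmap)
import Relation.Binary.Construct.On as On
open import Relation.Binary.Definitions using (DecidableEquality; _Respects_)
open import Relation.Binary.PropositionalEquality
  using (_≡_; _≢_; _≗_; refl; sym; trans; cong; cong₂; subst; subst₂; module ≡-Reasoning)
open import Relation.Binary.Structures using (IsDecEquivalence; IsTotalOrder)

open +-*-Solver using (solve; _:+_; _:*_; _:-_; :-_; con; _:=_)

private variable
  A B : Set

module ListSum {R : Set} {plus times : R → R → R} {0# 1# : R}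
  (isCommutativeSemiring : IsCommutativeSemiring _≡_ plus times 0# 1#) where

  private
    infixl 6 _⊕_
    infixl 7 _⊗_

    _⊕_ _⊗_ : R → R → R
    _⊕_ = plus
    _⊗_ = times

  open IsCommutativeSemiring isCommutativeSemiring
    using (+-assoc; +-comm; +-identityˡ; *-identityˡ; *-identityʳ; distribˡ; distribʳ; zeroˡ; zeroʳ)
  open ≡-Reasoning

  ∑ : (A → R) → List A → R
  ∑ f []       = 0#
  ∑ f (x ∷ xs) = f x ⊕ ∑ f xs

  ∑-cong-∈ : ∀ {f g : A → R} xs → (∀ x → x ∈ˡ xs → f x ≡ g x) → ∑ f xs ≡ ∑ g xs
  ∑-cong-∈ []       f≡g = refl
  ∑-cong-∈ (x ∷ xs) f≡g = cong₂ _⊕_ (f≡g x (here refl)) (∑-cong-∈ xs (λ y y∈xs → f≡g y (there y∈xs)))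

  ∑-cong : ∀ {f g : A → R} xs → (∀ x → f x ≡ g x) → ∑ f xs ≡ ∑ g xs
  ∑-cong xs f≡g = ∑-cong-∈ xs (λ x _ → f≡g x)

  ∑-zero : ∀ {f : A → R} xs → (∀ x → f x ≡ 0#) → ∑ f xs ≡ 0#
  ∑-zero []       f≡0 = refl
  ∑-zero (x ∷ xs) f≡0 = trans (cong₂ _⊕_ (f≡0 x) (∑-zero xs f≡0)) (+-identityˡ 0#)

  ∑-distrib-+ : ∀ (f g : A → R) xs → ∑ (λ x → f x ⊕ g x) xs ≡ ∑ f xs ⊕ ∑ g xs
  ∑-distrib-+ f g []       = sym (+-identityˡ 0#)
  ∑-distrib-+ f g (x ∷ xs) = begin
    (f x ⊕ g x) ⊕ ∑ (λ x → f x ⊕ g x) xs  ≡⟨ cong ((f x ⊕ g x) ⊕_) (∑-distrib-+ f g xs) ⟩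
    (f x ⊕ g x) ⊕ (∑ f xs ⊕ ∑ g xs)       ≡⟨ +-assoc (f x) (g x) _ ⟩
    f x ⊕ (g x ⊕ (∑ f xs ⊕ ∑ g xs))       ≡⟨ cong (f x ⊕_) (sym (+-assoc (g x) _ _)) ⟩
    f x ⊕ ((g x ⊕ ∑ f xs) ⊕ ∑ g xs)       ≡⟨ cong (λ y → f x ⊕ (y ⊕ ∑ g xs)) (+-comm (g x) _) ⟩
    f x ⊕ ((∑ f xs ⊕ g x) ⊕ ∑ g xs)       ≡⟨ cong (f x ⊕_) (+-assoc (∑ f xs) (g x) _) ⟩
    f x ⊕ (∑ f xs ⊕ (g x ⊕ ∑ g xs))       ≡⟨ sym (+-assoc (f x) _ _) ⟩
    (f x ⊕ ∑ f xs) ⊕ (g x ⊕ ∑ g xs)       ∎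

  ∑-*ˡ : ∀ c (f : A → R) xs → ∑ (λ x → c ⊗ f x) xs ≡ c ⊗ ∑ f xs
  ∑-*ˡ c f []       = sym (zeroʳ c)
  ∑-*ˡ c f (x ∷ xs) = trans (cong (c ⊗ f x ⊕_) (∑-*ˡ c f xs)) (sym (distribˡ c (f x) (∑ f xs)))

  ∑-*ʳ : ∀ c (f : A → R) xs → ∑ (λ x → f x ⊗ c) xs ≡ ∑ f xs ⊗ c
  ∑-*ʳ c f []       = sym (zeroˡ c)
  ∑-*ʳ c f (x ∷ xs) = trans (cong (f x ⊗ c ⊕_) (∑-*ʳ c f xs)) (sym (distribʳ c (f x) (∑ f xs)))

  ∑-++ : ∀ (f : A → R) xs ys → ∑ f (xs ++ ys) ≡ ∑ f xs ⊕ ∑ f ys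
  ∑-++ f []       ys = sym (+-identityˡ _)
  ∑-++ f (x ∷ xs) ys = trans (cong (f x ⊕_) (∑-++ f xs ys)) (sym (+-assoc (f x) _ _))

  ∑-map : ∀ (f : B → R) (g : A → B) xs → ∑ f (map g xs) ≡ ∑ (f ∘ g) xs
  ∑-map f g []       = refl
  ∑-map f g (x ∷ xs) = cong (f (g x) ⊕_) (∑-map f g xs)

  ∑-concatMap : ∀ (f : B → R) (g : A → List B) xs → ∑ f (concatMap g xs) ≡ ∑ (∑ f ∘ g) xs
  ∑-concatMap f g []       = refl
  ∑-concatMap f g (x ∷ xs) =
    trans (∑-++ f (g x) (concat (map g xs))) (cong (∑ f (g x) ⊕_) (∑-concatMap f g xs))

  ∑-comm : ∀ (f : A → B → R) xs ys → ∑ (λ x → ∑ (f x) ys) xs ≡ ∑ (λ y → ∑ (λ x → f x y) xs) ys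
  ∑-comm f []       ys = sym (∑-zero ys (λ _ → refl))
  ∑-comm f (x ∷ xs) ys = trans (cong (∑ (f x) ys ⊕_) (∑-comm f xs ys))
    (sym (∑-distrib-+ (f x) (λ y → ∑ (λ x′ → f x′ y) xs) ys))

  ∑-cartesianProduct : ∀ (f : A × B → R) xs ys →
    ∑ f (cartesianProduct xs ys) ≡ ∑ (λ x → ∑ (λ y → f (x , y)) ys) xs
  ∑-cartesianProduct f []       ys = refl
  ∑-cartesianProduct f (x ∷ xs) ys = trans (∑-++ f (map (x ,_) ys) (cartesianProduct xs ys))
    (cong₂ _⊕_ (∑-map f (x ,_) ys) (∑-cartesianProduct f xs ys))

  𝟙[_] : ∀ {P : Set} → Dec P → R
  𝟙[ yes _ ] = 1#
  𝟙[ no _ ]  = 0#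

  𝟙-yes : ∀ {P : Set} (P? : Dec P) → P → 𝟙[ P? ] ≡ 1#
  𝟙-yes (yes _) _ = refl
  𝟙-yes (no ¬p) p = ⊥-elim (¬p p)

  𝟙-no : ∀ {P : Set} (P? : Dec P) → ¬ P → 𝟙[ P? ] ≡ 0#
  𝟙-no (yes p) ¬p = ⊥-elim (¬p p)
  𝟙-no (no _)  _  = refl

  𝟙-by-cases : ∀ {P : Set} (P? : Dec P) {x} → (P → x ≡ 1#) → (¬ P → x ≡ 0#) → 𝟙[ P? ] ≡ x
  𝟙-by-cases (yes p) P⇒x≡1 _  = sym (P⇒x≡1 p)
  𝟙-by-cases (no ¬p) _ ¬P⇒x≡0 = sym (¬P⇒x≡0 ¬p)

  *𝟙-by-cases : ∀ {P : Set} (P? : Dec P) {x c} → (P → x ≡ c) → (¬ P → x ≡ 0#) → x ≡ c ⊗ 𝟙[ P? ]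
  *𝟙-by-cases (yes p) P⇒x≡c _  = trans (P⇒x≡c p) (sym (*-identityʳ _))
  *𝟙-by-cases (no ¬p) _ ¬P⇒x≡0 = trans (¬P⇒x≡0 ¬p) (sym (zeroʳ _))

  𝟙-cong : ∀ {P Q : Set} (P? : Dec P) (Q? : Dec Q) → (P → Q) → (Q → P) → 𝟙[ P? ] ≡ 𝟙[ Q? ]
  𝟙-cong (yes _) (yes _) _   _   = refl
  𝟙-cong (yes p) (no ¬q) p→q _   = ⊥-elim (¬q (p→q p))
  𝟙-cong (no ¬p) (yes q) _   q→p = ⊥-elim (¬p (q→p q))
  𝟙-cong (no _)  (no _)  _   _   = refl

  𝟙-× : ∀ {P Q : Set} (P? : Dec P) (Q? : Dec Q) → 𝟙[ P? ×-dec Q? ] ≡ 𝟙[ P? ] ⊗ 𝟙[ Q? ]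
  𝟙-× (yes _) (yes _) = sym (*-identityˡ 1#)
  𝟙-× (yes _) (no _)  = sym (*-identityˡ 0#)
  𝟙-× (no _)  Q?      = sym (zeroˡ 𝟙[ Q? ])

  count : ∀ {P : A → Set} → Decidable P → List A → R
  count P? = ∑ (λ x → 𝟙[ P? x ])

  count-cong : ∀ {P Q : A → Set} (P? : Decidable P) (Q? : Decidable Q) xs →
    (∀ x → x ∈ˡ xs → P x → Q x) → (∀ x → x ∈ˡ xs → Q x → P x) → count P? xs ≡ count Q? xs
  count-cong P? Q? xs P⇒Q Q⇒P = ∑-cong-∈ xs (λ x x∈xs → 𝟙-cong (P? x) (Q? x) (P⇒Q x x∈xs) (Q⇒P x x∈xs))

  count-none : ∀ {P : A → Set} (P? : Decidable P) xs → (∀ x → ¬ P x) → count P? xs ≡ 0#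
  count-none P? xs ¬P = ∑-zero xs (λ x → 𝟙-no (P? x) (¬P x))

  count-cartesianProduct : ∀ {P : A → Set} {Q : B → Set} (P? : Decidable P) (Q? : Decidable Q) xs ys →
    count (λ p → P? (proj₁ p) ×-dec Q? (proj₂ p)) (cartesianProduct xs ys) ≡ count P? xs ⊗ count Q? ys
  count-cartesianProduct P? Q? xs ys = begin
    count (λ p → P? (proj₁ p) ×-dec Q? (proj₂ p)) (cartesianProduct xs ys)
      ≡⟨ ∑-cartesianProduct _ xs ys ⟩
    ∑ (λ x → ∑ (λ y → 𝟙[ P? x ×-dec Q? y ]) ys) xs
      ≡⟨ ∑-cong xs (λ x → trans (∑-cong ys (λ y → 𝟙-× (P? x) (Q? y))) (∑-*ˡ 𝟙[ P? x ] _ ys)) ⟩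
    ∑ (λ x → 𝟙[ P? x ] ⊗ count Q? ys) xs
      ≡⟨ ∑-*ʳ (count Q? ys) _ xs ⟩
    count P? xs ⊗ count Q? ys ∎

  ∑-δ : ∀ (_≟_ : DecidableEquality A) (f : A → R) xs y →
    ∑ (λ x → 𝟙[ x ≟ y ] ⊗ f x) xs ≡ count (_≟ y) xs ⊗ f y
  ∑-δ _≟_ f xs y = trans (∑-cong xs δ-substitute) (∑-*ʳ (f y) _ xs)
    where
    δ-substitute : ∀ x → 𝟙[ x ≟ y ] ⊗ f x ≡ 𝟙[ x ≟ y ] ⊗ f y
    δ-substitute x with x ≟ y
    ... | yes refl = refl
    ... | no _     = trans (zeroˡ (f x)) (sym (zeroˡ (f y)))

  count-fibres : ∀ {P : A → Set} (P? : Decidable P) {F : A → B → Set} (F? : ∀ x y → Dec (F x y)) xs ys →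
    (∀ x → P x → count (F? x) ys ≡ 1#) → (∀ x y → F x y → P x) →
    count P? xs ≡ ∑ (λ y → count (λ x → F? x y) xs) ys
  count-fibres P? F? xs ys unique-fibre F⇒P = trans (∑-cong xs 𝟙≡fibre) (∑-comm (λ x y → 𝟙[ F? x y ]) xs ys)
    where
    𝟙≡fibre : ∀ x → 𝟙[ P? x ] ≡ count (F? x) ys
    𝟙≡fibre x with P? x
    ... | yes p = sym (unique-fibre x p)
    ... | no ¬p = sym (count-none (F? x) ys (λ y r → ¬p (F⇒P x y r)))

-- Inverting a lower triangular matrix over ℚ

module ℚΣ = ListSum (IsCommutativeRing.isCommutativeSemiring ℚP.+-*-isCommutativeRing)

∑-neg : ∀ (f : A → ℚ) xs → ℚΣ.∑ (λ x → - f x) xs ≡ - ℚΣ.∑ f xs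
∑-neg f []       = refl
∑-neg f (x ∷ xs) = trans (cong (- f x +ℚ_) (∑-neg f xs)) (sym (ℚP.neg-distrib-+ (f x) (ℚΣ.∑ f xs)))

module LowerTriangularInverse
  {I : Set} (_≟_ : DecidableEquality I) (size : I → ℕ) (atMost : ℕ → List I)
  (atMost-count : ∀ s i → ℚΣ.count (_≟ i) (atMost s) ≡ ℚΣ.𝟙[ size i ≤? s ])
  (M : I → I → ℚ) (d : I → ℚ)
  (M-lower : ∀ i j → i ≢ j → ¬ size j < size i → M i j ≡ 0ℚ)
  (M*d≡1 : ∀ i → M i i *ℚ d i ≡ 1ℚ)
  where

  open ℚΣ

  Σ≤ : ℕ → (I → ℚ) → ℚ
  Σ≤ s f = ∑ f (atMost s)

  δ : I → I → ℚ
  δ i k = 𝟙[ i ≟ k ]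

  δ-sym : ∀ i k → δ i k ≡ δ k i
  δ-sym i k = 𝟙-cong (i ≟ k) (k ≟ i) sym sym

  Σ≤-δ : ∀ s i f → Σ≤ s (λ l → δ l i *ℚ f l) ≡ 𝟙[ size i ≤? s ] *ℚ f i
  Σ≤-δ s i f = trans (∑-δ _≟_ f (atMost s) i) (cong (_*ℚ f i) (atMost-count s i))

  𝟙≤*f≡f : ∀ s i (f : I → ℚ) → size i ≤ s ⊎ f i ≡ 0ℚ → 𝟙[ size i ≤? s ] *ℚ f i ≡ f i
  𝟙≤*f≡f s i f (inj₁ i≤s)  = trans (cong (_*ℚ f i) (𝟙-yes (size i ≤? s) i≤s)) (ℚP.*-identityˡ (f i))
  𝟙≤*f≡f s i f (inj₂ fi≡0) =
    trans (cong (𝟙[ size i ≤? s ] *ℚ_) fi≡0) (trans (ℚP.*-zeroʳ 𝟙[ size i ≤? s ]) (sym fi≡0))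

  Σ≤-δ-≤ : ∀ s i f → size i ≤ s → Σ≤ s (λ l → δ l i *ℚ f l) ≡ f i
  Σ≤-δ-≤ s i f i≤s = trans (Σ≤-δ s i f) (𝟙≤*f≡f s i f (inj₁ i≤s))

  -- Expanding f b as Σ≤ s₀ (λ a → δ a b *ℚ f a) and exchanging the two sums.
  Σ≤-truncate : ∀ s₀ s (f : I → ℚ) → s₀ ≤ s → (∀ a → size a ≤ s₀ ⊎ f a ≡ 0ℚ) → Σ≤ s f ≡ Σ≤ s₀ f
  Σ≤-truncate s₀ s f s₀≤s f-supported = begin
    Σ≤ s f
      ≡⟨ ∑-cong (atMost s) (λ b → sym (trans (Σ≤-δ s₀ b f) (𝟙≤*f≡f s₀ b f (f-supported b)))) ⟩
    Σ≤ s (λ b → Σ≤ s₀ (λ a → δ a b *ℚ f a))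
      ≡⟨ ∑-comm (λ b a → δ a b *ℚ f a) (atMost s) (atMost s₀) ⟩
    Σ≤ s₀ (λ a → Σ≤ s (λ b → δ a b *ℚ f a))
      ≡⟨ ∑-cong (atMost s₀) (λ a → trans (∑-cong (atMost s) (λ b → cong (_*ℚ f a) (δ-sym a b)))
            (trans (Σ≤-δ s a (λ _ → f a)) (𝟙≤*f≡f s a f (widen (f-supported a))))) ⟩
    Σ≤ s₀ f ∎
    where
    open ≡-Reasoning
    widen : ∀ {a} → size a ≤ s₀ ⊎ f a ≡ 0ℚ → size a ≤ s ⊎ f a ≡ 0ℚ
    widen (inj₁ a≤s₀) = inj₁ (ℕP.≤-trans a≤s₀ s₀≤s)
    widen (inj₂ fa≡0) = inj₂ fa≡0

  M< : I → I → ℚ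
  M< i l = 𝟙[ size l <? size i ] *ℚ M i l

  M-split : ∀ i l → M i l ≡ δ i l *ℚ M i i +ℚ M< i l
  M-split i l with i ≟ l | size l <? size i
  ... | yes refl | yes l<l = ⊥-elim (ℕP.<-irrefl refl l<l)
  ... | yes refl | no _    = solve 1 (λ m → m := con 1ℚ :* m :+ con 0ℚ :* m) refl (M i i)
  ... | no _     | yes _   = solve 2 (λ m n → m := con 0ℚ :* n :+ con 1ℚ :* m) refl (M i l) (M i i)
  ... | no i≢l   | no l≮i  = trans (M-lower i l i≢l l≮i)
                                    (solve 2 (λ m n → con 0ℚ := con 0ℚ :* n :+ con 0ℚ :* m) refl (M i l) (M i i))

  private
    _<ₛ_ : I → I → Set
    _<ₛ_ = _<_ on size

    <ₛ-wellFounded = On.wellFounded size ℕInd.<-wellFounded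

    below : ∀ i l → WfRec _<ₛ_ (λ _ → ℚ) i → ℚ
    below i l N< with size l <? size i
    ... | yes l<i = M i l *ℚ N< l<i
    ... | no _    = 0ℚ

    column-step : ∀ k i → WfRec _<ₛ_ (λ _ → ℚ) i → ℚ
    column-step k i N< = d i *ℚ (δ i k - Σ≤ (size i) (λ l → below i l N<))

    column-step-ext : ∀ k i {N< N<′ : WfRec _<ₛ_ (λ _ → ℚ) i} → (∀ {l} l<i → N< {l} l<i ≡ N<′ l<i) →
      column-step k i N< ≡ column-step k i N<′
    column-step-ext k i N<≡N<′ = cong (λ x → d i *ℚ (δ i k - x)) (∑-cong (atMost (size i)) below-ext)
      where
      below-ext : ∀ l → below i l _ ≡ below i l _
      below-ext l with size l <? size i
      ... | yes l<i = cong (M i l *ℚ_) (N<≡N<′ l<i)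
      ... | no _    = refl

  -- Forward substitution, by well-founded recursion on size i for each column k.
  N : I → I → ℚ
  N i k = All.wfRec <ₛ-wellFounded 0ℓ (λ _ → ℚ) (column-step k) i

  X : I → I → ℚ
  X i k = Σ≤ (size i) (λ l → M< i l *ℚ N l k)

  N-unfold : ∀ i k → N i k ≡ d i *ℚ (δ i k - X i k)
  N-unfold i k = trans (FixPoint.unfold-wfRec <ₛ-wellFounded (λ _ → ℚ) (column-step k) (column-step-ext k))
    (cong (λ x → d i *ℚ (δ i k - x)) (∑-cong (atMost (size i)) below≡))
    where
    below≡ : ∀ l → below i l (λ {l} _ → N l k) ≡ M< i l *ℚ N l k
    below≡ l with size l <? size i
    ... | yes _ = cong (_*ℚ N l k) (sym (ℚP.*-identityˡ (M i l)))
    ... | no _  = sym (trans (cong (_*ℚ N l k) (ℚP.*-zeroˡ (M i l))) (ℚP.*-zeroˡ (N l k)))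

  size-ind : (P : I → Set) → (∀ i → (∀ l → size l < size i → P l) → P i) → ∀ i → P i
  size-ind P step = All.wfRec <ₛ-wellFounded 0ℓ P (λ i below-i → step i (λ _ → below-i))

  M<-outside : ∀ i l → ¬ size l < size i → M< i l ≡ 0ℚ
  M<-outside i l l≮i = trans (cong (_*ℚ M i l) (𝟙-no (size l <? size i) l≮i)) (ℚP.*-zeroˡ (M i l))

  M<*x≡0 : ∀ i l x → ¬ size l < size i ⊎ x ≡ 0ℚ → M< i l *ℚ x ≡ 0ℚ
  M<*x≡0 i l x (inj₁ l≮i) = trans (cong (_*ℚ x) (M<-outside i l l≮i)) (ℚP.*-zeroˡ x)
  M<*x≡0 i l x (inj₂ x≡0) = trans (cong (M< i l *ℚ_) x≡0) (ℚP.*-zeroʳ (M< i l))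

  N-lower : ∀ i k → k ≢ i → size i ≤ size k → N i k ≡ 0ℚ
  N-lower = size-ind (λ i → ∀ k → k ≢ i → size i ≤ size k → N i k ≡ 0ℚ) step
    where
    step : ∀ i → (∀ l → size l < size i → ∀ k → k ≢ l → size l ≤ size k → N l k ≡ 0ℚ) →
      ∀ k → k ≢ i → size i ≤ size k → N i k ≡ 0ℚ
    step i N-lower-below k k≢i i≤k = begin
      N i k                   ≡⟨ N-unfold i k ⟩
      d i *ℚ (δ i k - X i k)  ≡⟨ cong₂ (λ δ x → d i *ℚ (δ - x)) (𝟙-no (i ≟ k) (k≢i ∘ sym)) (∑-zero (atMost (size i)) X-term≡0) ⟩
      d i *ℚ (0ℚ - 0ℚ)        ≡⟨ solve 1 (λ x → x :* (con 0ℚ :- con 0ℚ) := con 0ℚ) refl (d i) ⟩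
      0ℚ ∎
      where
      open ≡-Reasoning
      X-term≡0 : ∀ l → M< i l *ℚ N l k ≡ 0ℚ
      X-term≡0 l = M<*x≡0 i l (N l k) (outside-or-zero (size l <? size i))
        where
        outside-or-zero : Dec (size l < size i) → ¬ size l < size i ⊎ N l k ≡ 0ℚ
        outside-or-zero (no l≮i)  = inj₁ l≮i
        outside-or-zero (yes l<i) =
          inj₂ (N-lower-below l l<i k (λ { refl → ℕP.<⇒≱ l<i i≤k }) (ℕP.≤-trans (ℕP.<⇒≤ l<i) i≤k))

  private
    cancel : ∀ m d′ a x → m *ℚ d′ ≡ 1ℚ → m *ℚ (d′ *ℚ (a - x)) +ℚ x ≡ a
    cancel m d′ a x m*d′≡1 = begin
      m *ℚ (d′ *ℚ (a - x)) +ℚ x  ≡⟨ solve 4 (λ m d a x → m :* (d :* (a :- x)) :+ x := (m :* d) :* (a :- x) :+ x) refl m d′ a x ⟩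
      (m *ℚ d′) *ℚ (a - x) +ℚ x  ≡⟨ cong (λ y → y *ℚ (a - x) +ℚ x) m*d′≡1 ⟩
      1ℚ *ℚ (a - x) +ℚ x         ≡⟨ solve 2 (λ a x → con 1ℚ :* (a :- x) :+ x := a) refl a x ⟩
      a ∎
      where open ≡-Reasoning

  M*N≡δ : ∀ i k → Σ≤ (size i) (λ j → M i j *ℚ N j k) ≡ δ i k
  M*N≡δ i k = begin
    Σ≤ (size i) (λ j → M i j *ℚ N j k)
      ≡⟨ ∑-cong (atMost (size i)) split ⟩
    Σ≤ (size i) (λ j → δ j i *ℚ (M i i *ℚ N j k) +ℚ M< i j *ℚ N j k)
      ≡⟨ ∑-distrib-+ (λ j → δ j i *ℚ (M i i *ℚ N j k)) (λ j → M< i j *ℚ N j k) (atMost (size i)) ⟩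
    Σ≤ (size i) (λ j → δ j i *ℚ (M i i *ℚ N j k)) +ℚ X i k
      ≡⟨ cong (_+ℚ X i k) (Σ≤-δ-≤ (size i) i (λ j → M i i *ℚ N j k) ℕP.≤-refl) ⟩
    M i i *ℚ N i k +ℚ X i k
      ≡⟨ cong (λ n → M i i *ℚ n +ℚ X i k) (N-unfold i k) ⟩
    M i i *ℚ (d i *ℚ (δ i k - X i k)) +ℚ X i k
      ≡⟨ cancel (M i i) (d i) (δ i k) (X i k) (M*d≡1 i) ⟩
    δ i k ∎
    where
    open ≡-Reasoning
    split : ∀ j → M i j *ℚ N j k ≡ δ j i *ℚ (M i i *ℚ N j k) +ℚ M< i j *ℚ N j k
    split j = begin
      M i j *ℚ N j k
        ≡⟨ cong (_*ℚ N j k) (M-split i j) ⟩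
      (δ i j *ℚ M i i +ℚ M< i j) *ℚ N j k
        ≡⟨ solve 4 (λ δ m m< n → (δ :* m :+ m<) :* n := δ :* (m :* n) :+ m< :* n)
          refl (δ i j) (M i i) (M< i j) (N j k) ⟩
      δ i j *ℚ (M i i *ℚ N j k) +ℚ M< i j *ℚ N j k
        ≡⟨ cong (λ δ → δ *ℚ (M i i *ℚ N j k) +ℚ M< i j *ℚ N j k) (δ-sym i j) ⟩
      δ j i *ℚ (M i i *ℚ N j k) +ℚ M< i j *ℚ N j k ∎

  module _ (i k : I) (N*M≡δ-below : ∀ l → size l < size i → Σ≤ (size l) (λ j → N l j *ℚ M j k) ≡ δ l k) where

    private
      N*M-row : ∀ l → size l < size i → Σ≤ (size i) (λ j → N l j *ℚ M j k) ≡ δ l k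
      N*M-row l l<i = trans (Σ≤-truncate (size l) (size i) _ (ℕP.<⇒≤ l<i) supported) (N*M≡δ-below l l<i)
        where
        supported : ∀ j → size j ≤ size l ⊎ N l j *ℚ M j k ≡ 0ℚ
        supported j with size j ≤? size l
        ... | yes j≤l = inj₁ j≤l
        ... | no j≰l  = inj₂ (trans (cong (_*ℚ M j k) (N-lower l j (λ { refl → j≰l ℕP.≤-refl }) (ℕP.≰⇒≥ j≰l)))
                                    (ℚP.*-zeroˡ (M j k)))

      M<*N*M : ∀ l → Dec (size l < size i) → M< i l *ℚ Σ≤ (size i) (λ j → N l j *ℚ M j k) ≡ δ l k *ℚ M< i l
      M<*N*M l (yes l<i) = trans (cong (M< i l *ℚ_) (N*M-row l l<i)) (ℚP.*-comm (M< i l) (δ l k))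
      M<*N*M l (no l≮i)  = trans (M<*x≡0 i l _ (inj₁ l≮i))
                                 (sym (trans (cong (δ l k *ℚ_) (M<-outside i l l≮i)) (ℚP.*-zeroʳ (δ l k))))

      inside-or-zero : Dec (size k < size i) → size k ≤ size i ⊎ M< i k ≡ 0ℚ
      inside-or-zero (yes k<i) = inj₁ (ℕP.<⇒≤ k<i)
      inside-or-zero (no k≮i)  = inj₂ (M<-outside i k k≮i)

    X*M≡M< : Σ≤ (size i) (λ j → X i j *ℚ M j k) ≡ M< i k
    X*M≡M< = begin
      Σ≤ (size i) (λ j → X i j *ℚ M j k)
        ≡⟨ ∑-cong (atMost (size i)) (λ j → trans (sym (∑-*ʳ (M j k) (λ l → M< i l *ℚ N l j) (atMost (size i))))
                                                (∑-cong (atMost (size i)) (λ l → ℚP.*-assoc (M< i l) (N l j) (M j k)))) ⟩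
      Σ≤ (size i) (λ j → Σ≤ (size i) (λ l → M< i l *ℚ (N l j *ℚ M j k)))
        ≡⟨ ∑-comm (λ j l → M< i l *ℚ (N l j *ℚ M j k)) (atMost (size i)) (atMost (size i)) ⟩
      Σ≤ (size i) (λ l → Σ≤ (size i) (λ j → M< i l *ℚ (N l j *ℚ M j k)))
        ≡⟨ ∑-cong (atMost (size i)) (λ l → trans (∑-*ˡ (M< i l) (λ j → N l j *ℚ M j k) (atMost (size i)))
                                                (M<*N*M l (size l <? size i))) ⟩
      Σ≤ (size i) (λ l → δ l k *ℚ M< i l)
        ≡⟨ Σ≤-δ (size i) k (M< i) ⟩
      𝟙[ size k ≤? size i ] *ℚ M< i k
        ≡⟨ 𝟙≤*f≡f (size i) k (M< i) (inside-or-zero (size k <? size i)) ⟩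
      M< i k ∎
      where open ≡-Reasoning

  N*M≡δ : ∀ i k → Σ≤ (size i) (λ j → N i j *ℚ M j k) ≡ δ i k
  N*M≡δ = size-ind (λ i → ∀ k → Σ≤ (size i) (λ j → N i j *ℚ M j k) ≡ δ i k) step
    where
    step : ∀ i → (∀ l → size l < size i → ∀ k → Σ≤ (size l) (λ j → N l j *ℚ M j k) ≡ δ l k) →
      ∀ k → Σ≤ (size i) (λ j → N i j *ℚ M j k) ≡ δ i k
    step i N*M≡δ-below k = begin
      Σ≤ (size i) (λ j → N i j *ℚ M j k)
        ≡⟨ ∑-cong (atMost (size i)) expand ⟩
      Σ≤ (size i) (λ j → d i *ℚ (δ j i *ℚ M j k +ℚ - (X i j *ℚ M j k)))
        ≡⟨ ∑-*ˡ (d i) _ (atMost (size i)) ⟩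
      d i *ℚ Σ≤ (size i) (λ j → δ j i *ℚ M j k +ℚ - (X i j *ℚ M j k))
        ≡⟨ cong (d i *ℚ_) (∑-distrib-+ (λ j → δ j i *ℚ M j k) (λ j → - (X i j *ℚ M j k)) (atMost (size i))) ⟩
      d i *ℚ (Σ≤ (size i) (λ j → δ j i *ℚ M j k) +ℚ Σ≤ (size i) (λ j → - (X i j *ℚ M j k)))
        ≡⟨ cong₂ (λ a b → d i *ℚ (a +ℚ b)) (Σ≤-δ-≤ (size i) i (λ j → M j k) ℕP.≤-refl)
                                           (∑-neg (λ j → X i j *ℚ M j k) (atMost (size i))) ⟩
      d i *ℚ (M i k +ℚ - Σ≤ (size i) (λ j → X i j *ℚ M j k))
        ≡⟨ cong (λ y → d i *ℚ (M i k +ℚ - y)) (X*M≡M< i k (λ l l<i → N*M≡δ-below l l<i k)) ⟩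
      d i *ℚ (M i k +ℚ - M< i k)
        ≡⟨ cong (λ y → d i *ℚ (y +ℚ - M< i k)) (M-split i k) ⟩
      d i *ℚ (δ i k *ℚ M i i +ℚ M< i k +ℚ - M< i k)
        ≡⟨ solve 4 (λ d δ m m< → d :* (δ :* m :+ m< :+ :- m<) := δ :* (m :* d)) refl (d i) (δ i k) (M i i) (M< i k) ⟩
      δ i k *ℚ (M i i *ℚ d i)
        ≡⟨ trans (cong (δ i k *ℚ_) (M*d≡1 i)) (ℚP.*-identityʳ (δ i k)) ⟩
      δ i k ∎
      where
      open ≡-Reasoning
      expand : ∀ j → N i j *ℚ M j k ≡ d i *ℚ (δ j i *ℚ M j k +ℚ - (X i j *ℚ M j k))
      expand j = begin
        N i j *ℚ M j k
          ≡⟨ cong (_*ℚ M j k) (N-unfold i j) ⟩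
        d i *ℚ (δ i j - X i j) *ℚ M j k
          ≡⟨ solve 4 (λ d δ x m → d :* (δ :- x) :* m := d :* (δ :* m :+ :- (x :* m)))
            refl (d i) (δ i j) (X i j) (M j k) ⟩
        d i *ℚ (δ i j *ℚ M j k +ℚ - (X i j *ℚ M j k))
          ≡⟨ cong (λ δ → d i *ℚ (δ *ℚ M j k +ℚ - (X i j *ℚ M j k))) (δ-sym i j) ⟩
        d i *ℚ (δ j i *ℚ M j k +ℚ - (X i j *ℚ M j k)) ∎

module ℕΣ = ListSum ℕP.+-*-isCommutativeSemiring
open ℕΣ

length-filter≡count : ∀ {P : A → Set} (P? : Decidable P) xs → length (filter P? xs) ≡ count P? xs
length-filter≡count P? []       = refl
length-filter≡count P? (x ∷ xs) with P? x
... | yes _ = cong suc (length-filter≡count P? xs)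
... | no _  = length-filter≡count P? xs

count≢0⇒∃ : ∀ {P : A → Set} (P? : Decidable P) xs → count P? xs ≢ 0 → ∃ λ x → x ∈ˡ xs × P x
count≢0⇒∃ P? []       count≢0 = ⊥-elim (count≢0 refl)
count≢0⇒∃ P? (x ∷ xs) count≢0 with P? x
... | yes p = x , here refl , p
... | no _  = let y , y∈xs , py = count≢0⇒∃ P? xs count≢0 in y , there y∈xs , py

∃⇒count≢0 : ∀ {P : A → Set} (P? : Decidable P) {xs x} → x ∈ˡ xs → P x → count P? xs ≢ 0
∃⇒count≢0 P? {y ∷ xs} x∈xs px with P? y
... | yes _ = λ ()
∃⇒count≢0 P? (here refl) px | no ¬px = ⊥-elim (¬px px)
∃⇒count≢0 P? (there x∈xs) px | no _ = ∃⇒count≢0 P? x∈xs px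

count≤length : ∀ {P : A → Set} (P? : Decidable P) xs → count P? xs ≤ length xs
count≤length P? []       = z≤n
count≤length P? (x ∷ xs) with P? x
... | yes _ = s≤s (count≤length P? xs)
... | no _  = ℕP.m≤n⇒m≤1+n (count≤length P? xs)

count-mono : ∀ {P Q : A → Set} (P? : Decidable P) (Q? : Decidable Q) xs →
  (∀ x → P x → Q x) → count P? xs ≤ count Q? xs
count-mono P? Q? []       P⇒Q = z≤n
count-mono P? Q? (x ∷ xs) P⇒Q with P? x | Q? x
... | yes _ | yes _ = s≤s (count-mono P? Q? xs P⇒Q)
... | yes p | no ¬q = ⊥-elim (¬q (P⇒Q x p))
... | no _  | yes _ = ℕP.m≤n⇒m≤1+n (count-mono P? Q? xs P⇒Q)
... | no _  | no _  = count-mono P? Q? xs P⇒Q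

count-mono-< : ∀ {P Q : A → Set} (P? : Decidable P) (Q? : Decidable Q) {xs y} →
  (∀ x → P x → Q x) → y ∈ˡ xs → Q y → ¬ P y → count P? xs < count Q? xs
count-mono-< P? Q? {x ∷ xs} P⇒Q y∈ qy ¬py with P? x | Q? x | y∈
... | yes px | _     | here refl = ⊥-elim (¬py px)
... | no _   | yes _ | here refl = s≤s (count-mono P? Q? xs P⇒Q)
... | no _   | no ¬q | here refl = ⊥-elim (¬q qy)
... | yes _  | yes _ | there y∈xs = s≤s (count-mono-< P? Q? P⇒Q y∈xs qy ¬py)
... | yes px | no ¬q | there _    = ⊥-elim (¬q (P⇒Q x px))
... | no _   | yes _ | there y∈xs = ℕP.m≤n⇒m≤1+n (count-mono-< P? Q? P⇒Q y∈xs qy ¬py)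
... | no _   | no _  | there y∈xs = count-mono-< P? Q? P⇒Q y∈xs qy ¬py

record Enumerates (S : DecSetoid 0ℓ 0ℓ) (xs : List (DecSetoid.Carrier S)) : Set where
  field
    occurs-once : ∀ x → count (λ y → DecSetoid._≟_ S y x) xs ≡ 1

open Enumerates public

≗-decSetoid : ℕ → ℕ → DecSetoid 0ℓ 0ℓ
≗-decSetoid n k = record { Carrier = Fin n → Fin k ; _≈_ = _≗_ ; isDecEquivalence = record
  { isEquivalence = record
    { refl = λ _ → refl ; sym = λ f≗g x → sym (f≗g x) ; trans = λ f≗g g≗h x → trans (f≗g x) (g≗h x) }
  ; _≟_ = λ f g → FinP.all? (λ x → f x Fin.≟ g x) } }

∑-allFin-suc : ∀ {n} (f : Fin (suc n) → ℕ) → ∑ f (allFin (suc n)) ≡ f zero + ∑ (f ∘ suc) (allFin n)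
∑-allFin-suc {n} f = cong (_+_ (f zero))
  (trans (cong (∑ f) (sym (ListP.map-tabulate (λ i → i) suc))) (∑-map f suc (allFin n)))

allFin-enumerates : ∀ n → Enumerates (FinP.≡-decSetoid n) (allFin n)
allFin-enumerates (suc n) .occurs-once zero    =
  trans (∑-allFin-suc {n} (λ j → 𝟙[ j Fin.≟ zero ]))
        (cong suc (count-none (λ j → suc j Fin.≟ zero) (allFin n) (λ _ ())))
allFin-enumerates (suc n) .occurs-once (suc i) = begin
  count (Fin._≟ suc i) (allFin (suc n))
    ≡⟨ ∑-allFin-suc {n} (λ j → 𝟙[ j Fin.≟ suc i ]) ⟩
  count (λ j → suc j Fin.≟ suc i) (allFin n)
    ≡⟨ count-cong _ (Fin._≟ i) (allFin n)
      (λ _ _ → FinP.suc-injective) (λ _ _ → cong suc) ⟩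
  count (Fin._≟ i) (allFin n)
    ≡⟨ allFin-enumerates n .occurs-once i ⟩
  1 ∎
  where open ≡-Reasoning

funs-enumerates : ∀ n k → Enumerates (≗-decSetoid n k) (funs n k)
funs-enumerates zero    k .occurs-once f = refl
funs-enumerates (suc n) k .occurs-once f = begin
  count (_≗? f) (concatMap (λ g → map (λ i → cons i g) (allFin k)) (funs n k))
    ≡⟨ ∑-concatMap _ _ (funs n k) ⟩
  ∑ (λ g → count (_≗? f) (map (λ i → cons i g) (allFin k))) (funs n k)
    ≡⟨ ∑-cong (funs n k) count-conses ⟩
  count (_≗′? (f ∘ suc)) (funs n k)
    ≡⟨ funs-enumerates n k .occurs-once (f ∘ suc) ⟩
  1 ∎
  where
  open ≡-Reasoning
  open DecSetoid (≗-decSetoid (suc n) k) using () renaming (_≟_ to _≗?_)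
  open DecSetoid (≗-decSetoid n k) using () renaming (_≟_ to _≗′?_)
  cons≗ : ∀ i g → 𝟙[ cons i g ≗? f ] ≡ 𝟙[ i Fin.≟ f zero ] * 𝟙[ g ≗′? (f ∘ suc) ]
  cons≗ i g = trans
    (𝟙-cong (cons i g ≗? f) ((i Fin.≟ f zero) ×-dec (g ≗′? (f ∘ suc)))
      (λ eq → eq zero , eq ∘ suc) (λ { (eq₀ , eqₛ) zero → eq₀ ; (eq₀ , eqₛ) (suc x) → eqₛ x }))
    (𝟙-× (i Fin.≟ f zero) (g ≗′? (f ∘ suc)))
  count-conses : ∀ g → count (_≗? f) (map (λ i → cons i g) (allFin k)) ≡ 𝟙[ g ≗′? (f ∘ suc) ]
  count-conses g = begin
    count (_≗? f) (map (λ i → cons i g) (allFin k))  ≡⟨ ∑-map _ (λ i → cons i g) (allFin k) ⟩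
    ∑ (λ i → 𝟙[ cons i g ≗? f ]) (allFin k)          ≡⟨ ∑-cong (allFin k) (λ i → cons≗ i g) ⟩
    ∑ (λ i → 𝟙[ i Fin.≟ f zero ] * rest) (allFin k)  ≡⟨ ∑-*ʳ rest (λ i → 𝟙[ i Fin.≟ f zero ]) (allFin k) ⟩
    count (Fin._≟ f zero) (allFin k) * rest          ≡⟨ cong (_* rest) (allFin-enumerates k .occurs-once (f zero)) ⟩
    1 * rest                                         ≡⟨ ℕP.*-identityˡ rest ⟩
    rest ∎
    where rest = 𝟙[ g ≗′? (f ∘ suc) ]

upTo-count : ∀ k m → count (ℕ._≟ m) (upTo k) ≡ 𝟙[ m <? k ]
upTo-count zero    m = refl
upTo-count (suc k) m = begin
  count (ℕ._≟ m) (upTo (suc k))                 ≡⟨ cong (count (ℕ._≟ m)) (sym (ListP.upTo-∷ʳ k)) ⟩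
  count (ℕ._≟ m) (upTo k ∷ʳ k)                  ≡⟨ ∑-++ _ (upTo k) [ k ] ⟩
  count (ℕ._≟ m) (upTo k) + (𝟙[ k ℕ.≟ m ] + 0)  ≡⟨ cong₂ _+_ (upTo-count k m) (ℕP.+-identityʳ _) ⟩
  𝟙[ m <? k ] + 𝟙[ k ℕ.≟ m ]                    ≡⟨ split (m <? suc k) ⟩
  𝟙[ m <? suc k ] ∎
  where
  open ≡-Reasoning
  split : (m<1+k? : Dec (m < suc k)) → 𝟙[ m <? k ] + 𝟙[ k ℕ.≟ m ] ≡ 𝟙[ m<1+k? ]
  split (no m≮1+k) = cong₂ _+_ (𝟙-no (m <? k) (m≮1+k ∘ ℕP.m<n⇒m<1+n))
                                 (𝟙-no (k ℕ.≟ m) (λ { refl → m≮1+k ℕP.≤-refl }))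
  split (yes m<1+k) with ℕP.m<1+n⇒m<n∨m≡n m<1+k
  ... | inj₁ m<k  = cong₂ _+_ (𝟙-yes (m <? k) m<k) (𝟙-no (k ℕ.≟ m) (λ { refl → ℕP.<-irrefl refl m<k }))
  ... | inj₂ refl = cong₂ _+_ (𝟙-no (m <? k) (ℕP.<-irrefl refl)) (𝟙-yes (k ℕ.≟ m) refl)

cartesianProduct-enumerates : ∀ {S T : DecSetoid 0ℓ 0ℓ} {xs ys} → Enumerates S xs → Enumerates T ys →
  Enumerates (×-decSetoid S T) (cartesianProduct xs ys)
cartesianProduct-enumerates {S} {T} {xs} {ys} enum-xs enum-ys .occurs-once (x , y) =
  trans (count-cartesianProduct (S._≟ x) (T._≟ y) xs ys) (cong₂ _*_ (enum-xs .occurs-once x) (enum-ys .occurs-once y))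
  where
  module S = DecSetoid S
  module T = DecSetoid T

module _ {S T : DecSetoid 0ℓ 0ℓ} where
  private
    module S = DecSetoid S
    module T = DecSetoid T

  count-bijection : ∀ {xs ys} → Enumerates S xs → Enumerates T ys →
    ∀ {P Q} (P? : Decidable P) (Q? : Decidable Q) (F : T.Carrier → S.Carrier) →
    P Respects S._≈_ → Q Respects T._≈_ → (∀ {y y′} → y T.≈ y′ → F y S.≈ F y′) →
    (∀ y → Q y → P (F y)) →
    (∀ x → P x → ∃ λ y → Q y × F y S.≈ x) →
    (∀ y y′ → Q y → Q y′ → F y S.≈ F y′ → y T.≈ y′) →
    count P? xs ≡ count Q? ys
  count-bijection {xs} {ys} enum-xs enum-ys {P} {Q} P? Q? F P-resp Q-resp F-cong F-into F-onto F-injective =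
    trans (count-fibres P? Preimage? xs ys unique-preimage preimage⇒P) (∑-cong ys count-preimages)
    where
    Preimage : S.Carrier → T.Carrier → Set
    Preimage x y = Q y × x S.≈ F y
    Preimage? : ∀ x y → Dec (Preimage x y)
    Preimage? x y = Q? y ×-dec (x S.≟ F y)
    unique-preimage : ∀ x → P x → count (Preimage? x) ys ≡ 1
    unique-preimage x px with F-onto x px
    ... | y₀ , qy₀ , Fy₀≈x = trans
      (count-cong (Preimage? x) (T._≟ y₀) ys
        (λ y _ (qy , x≈Fy) → T.sym (F-injective y₀ y qy₀ qy (S.trans Fy₀≈x x≈Fy)))
        (λ y _ y≈y₀ → Q-resp (T.sym y≈y₀) qy₀ , S.trans (S.sym Fy₀≈x) (F-cong (T.sym y≈y₀))))
      (enum-ys .occurs-once y₀)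
    preimage⇒P : ∀ x y → Preimage x y → P x
    preimage⇒P x y (qy , x≈Fy) = P-resp (S.sym x≈Fy) (F-into y qy)
    count-preimages : ∀ y → count (λ x → Preimage? x y) xs ≡ 𝟙[ Q? y ]
    count-preimages y with Q? y
    ... | yes qy = trans (count-cong (λ x → yes qy ×-dec (x S.≟ F y)) (S._≟ F y) xs (λ _ _ → proj₂) (λ _ _ x≈Fy → qy , x≈Fy))
                         (enum-xs .occurs-once (F y))
    ... | no ¬qy = count-none (λ x → no ¬qy ×-dec (x S.≟ F y)) xs (λ _ → ¬qy ∘ proj₁)

private
  coprime-1 : ∀ n → Coprime n 1
  coprime-1 n = coprime-sym (1-coprimeTo n)

  toℚ≡mkℚ : ∀ n → toℚ n ≡ mkℚ (+ n) 0 (coprime-1 n)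
  toℚ≡mkℚ n = ℚP.normalize-coprime (coprime-1 n)

toℚ-+ : ∀ m n → toℚ (m + n) ≡ toℚ m +ℚ toℚ n
toℚ-+ m n rewrite toℚ≡mkℚ m | toℚ≡mkℚ n =
  ℚP./-cong {p₁ = + (m + n)} (cong₂ ℤ._+_ (sym (ℤP.*-identityʳ (+ m))) (sym (ℤP.*-identityʳ (+ n)))) refl

toℚ-* : ∀ m n → toℚ (m * n) ≡ toℚ m *ℚ toℚ n
toℚ-* m n rewrite toℚ≡mkℚ m | toℚ≡mkℚ n = ℚP./-cong {p₁ = + (m * n)} (ℤP.pos-* m n) refl

toℚ*inv≡1 : ∀ n → n ≢ 0 → toℚ n *ℚ inv n ≡ 1ℚ
toℚ*inv≡1 zero    n≢0 = ⊥-elim (n≢0 refl)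
toℚ*inv≡1 (suc k) _   =
  trans (cong₂ _*ℚ_ (toℚ≡mkℚ (suc k)) inv≡1/) (ℚP.*-inverseʳ (mkℚ (+ suc k) 0 (coprime-1 (suc k))))
  where
  inv≡1/ : inv (suc k) ≡ 1/ mkℚ (+ suc k) 0 (coprime-1 (suc k))
  inv≡1/ = ℚP.normalize-coprime (coprime-sym (coprime-1 (suc k)))

sumℚ-map : ∀ (f : A → ℚ) xs → sumℚ (map f xs) ≡ ℚΣ.∑ f xs
sumℚ-map f []       = refl
sumℚ-map f (x ∷ xs) = cong (f x +ℚ_) (sumℚ-map f xs)

toℚ-∑ : ∀ (f : A → ℕ) xs → toℚ (ℕΣ.∑ f xs) ≡ ℚΣ.∑ (toℚ ∘ f) xs
toℚ-∑ f []       = refl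
toℚ-∑ f (x ∷ xs) = trans (toℚ-+ (f x) (ℕΣ.∑ f xs)) (cong (toℚ (f x) +ℚ_) (toℚ-∑ f xs))

toℚ-𝟙 : ∀ {P : Set} (P? : Dec P) → toℚ ℕΣ.𝟙[ P? ] ≡ ℚΣ.𝟙[ P? ]
toℚ-𝟙 (yes _) = refl
toℚ-𝟙 (no _)  = refl

toℚ-count : ∀ {P : A → Set} (P? : Decidable P) xs → toℚ (ℕΣ.count P? xs) ≡ ℚΣ.count P? xs
toℚ-count P? xs = trans (toℚ-∑ (λ x → ℕΣ.𝟙[ P? x ]) xs) (ℚΣ.∑-cong xs (toℚ-𝟙 ∘ P?))

toℚ-quotient : ∀ l j a s → a ≢ 0 → l * j ≡ a * s → toℚ l *ℚ inv a *ℚ toℚ j ≡ toℚ s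
toℚ-quotient l j a s a≢0 l*j≡a*s = begin
  toℚ l *ℚ inv a *ℚ toℚ j    ≡⟨ solve 3 (λ l i j → l :* i :* j := (l :* j) :* i) refl (toℚ l) (inv a) (toℚ j) ⟩
  (toℚ l *ℚ toℚ j) *ℚ inv a  ≡⟨ cong (_*ℚ inv a) (trans (sym (toℚ-* l j)) (trans (cong toℚ l*j≡a*s) (toℚ-* a s))) ⟩
  (toℚ a *ℚ toℚ s) *ℚ inv a  ≡⟨ solve 3 (λ a s i → (a :* s) :* i := s :* (a :* i)) refl (toℚ a) (toℚ s) (inv a) ⟩
  toℚ s *ℚ (toℚ a *ℚ inv a)  ≡⟨ trans (cong (toℚ s *ℚ_) (toℚ*inv≡1 a a≢0)) (ℚP.*-identityʳ (toℚ s)) ⟩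
  toℚ s ∎
  where open ≡-Reasoning

-- Walks of constant image

module _ (G : Hypergraph) {k : ℕ} (h : V G → Fin k) where

  Reach-mono : ∀ {t s u w} → t ≤ s → Reach G h t u w → Reach G h s u w
  Reach-mono {zero}  {zero}  _         r        = r
  Reach-mono {zero}  {suc s} _         r        = inj₁ (Reach-mono {zero} {s} z≤n r)
  Reach-mono {suc t} {suc s} (s≤s t≤s) (inj₁ r) = inj₁ (Reach-mono t≤s r)
  Reach-mono {suc t} {suc s} (s≤s t≤s) (inj₂ (v , e , r , v∈e , w∈e , hv≡hw)) =
    inj₂ (v , e , Reach-mono t≤s r , v∈e , w∈e , hv≡hw)

  Reach-refl : ∀ t u → Reach G h t u u
  Reach-refl t u = Reach-mono {zero} z≤n refl

  Reach⇒≡ : ∀ t {u w} → Reach G h t u w → h u ≡ h w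
  Reach⇒≡ zero    refl     = refl
  Reach⇒≡ (suc t) (inj₁ r) = Reach⇒≡ t r
  Reach⇒≡ (suc t) (inj₂ (_ , _ , r , _ , _ , hv≡hw)) = trans (Reach⇒≡ t r) hv≡hw

  Reach-trans : ∀ t s {u v w} → Reach G h t u v → Reach G h s v w → Reach G h (s + t) u w
  Reach-trans t zero    r refl      = r
  Reach-trans t (suc s) r (inj₁ r′) = inj₁ (Reach-trans t s r r′)
  Reach-trans t (suc s) r (inj₂ (x , e , r′ , x∈e , w∈e , hx≡hw)) =
    inj₂ (x , e , Reach-trans t s r r′ , x∈e , w∈e , hx≡hw)

  Reach-sym : ∀ t {u v} → Reach G h t u v → Reach G h t v u
  Reach-sym zero    refl     = refl
  Reach-sym (suc t) (inj₁ r) = inj₁ (Reach-sym t r)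
  Reach-sym (suc t) {u} {v} (inj₂ (x , e , r , x∈e , v∈e , hx≡hv)) =
    subst (λ s → Reach G h s v u) (ℕP.+-comm t 1)
      (Reach-trans 1 t (inj₂ (v , e , refl , v∈e , x∈e , sym hx≡hv)) (Reach-sym t r))

  Stable : ℕ → V G → Set
  Stable t u = ∀ w → Reach G h (suc t) u w → Reach G h t u w

  stable? : ∀ t u → Dec (Stable t u)
  stable? t u = FinP.all? (λ w → reach? G h (suc t) u w →-dec reach? G h t u w)

  Stable-suc : ∀ {t u} → Stable t u → Stable (suc t) u
  Stable-suc stable w (inj₁ r) = r
  Stable-suc stable w (inj₂ (v , e , r , v∈e , w∈e , hv≡hw)) = inj₂ (v , e , stable v r , v∈e , w∈e , hv≡hw)

  Stable-+ : ∀ {t u} → Stable t u → ∀ s {w} → Reach G h (s + t) u w → Reach G h t u w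
  Stable-+ stable zero    r = r
  Stable-+ stable (suc s) r = Stable-+ stable s (stable-from s _ r)
    where
    stable-from : ∀ s → Stable (s + _) _
    stable-from zero    = stable
    stable-from (suc s) = Stable-suc (stable-from s)

  #reachable : ℕ → V G → ℕ
  #reachable t u = count (reach? G h t u) (allFin (nV G))

  #reachable≤nV : ∀ t u → #reachable t u ≤ nV G
  #reachable≤nV t u = subst (#reachable t u ≤_) (ListP.length-tabulate (λ w → w))
    (count≤length (reach? G h t u) (allFin (nV G)))

  ¬Stable⇒new : ∀ {t u} → ¬ Stable t u → ∃ λ w → Reach G h (suc t) u w × ¬ Reach G h t u w
  ¬Stable⇒new {t} {u} ¬stable with FinP.¬∀⟶∃¬ (nV G) _ (λ w → reach? G h (suc t) u w →-dec reach? G h t u w) ¬stable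
  ... | w , ¬step with reach? G h (suc t) u w
  ...   | yes r = w , r , λ r′ → ¬step (λ _ → r′)
  ...   | no ¬r = ⊥-elim (¬step (λ r → ⊥-elim (¬r r)))

  -- The set of vertices reachable from u in at most t steps grows strictly until it is stable,
  -- so it is stable after at most |V(G)| steps.
  stable-or-growing : ∀ t u → (∃ λ t₀ → t₀ ≤ t × Stable t₀ u) ⊎ suc t ≤ #reachable t u
  stable-or-growing zero u =
    inj₂ (ℕP.n≢0⇒n>0 (∃⇒count≢0 (reach? G h zero u) (∈-allFin u) refl))
  stable-or-growing (suc t) u with stable-or-growing t u | stable? t u
  ... | inj₁ (t₀ , t₀≤t , stable) | _          = inj₁ (t₀ , ℕP.m≤n⇒m≤1+n t₀≤t , stable)
  ... | inj₂ _                    | yes stable = inj₁ (t , ℕP.n≤1+n t , stable)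
  ... | inj₂ growing              | no ¬stable =
    let w , new , ¬old = ¬Stable⇒new ¬stable in
    inj₂ (ℕP.<-≤-trans (s≤s growing)
      (count-mono-< (reach? G h t u) (reach? G h (suc t) u) (λ _ → inj₁) (∈-allFin w) new ¬old))

  stabilises : ∀ u → ∃ λ t₀ → t₀ ≤ nV G × Stable t₀ u
  stabilises u with stable-or-growing (nV G) u
  ... | inj₁ stable  = stable
  ... | inj₂ growing = ⊥-elim (ℕP.<-irrefl refl (ℕP.<-≤-trans growing (#reachable≤nV (nV G) u)))

  Reach-shorten : ∀ t {u w} → Reach G h t u w → Sim G h u w
  Reach-shorten t {u} r with stabilises u
  ... | t₀ , t₀≤nV , stable = Reach-mono t₀≤nV (Stable-+ stable t (Reach-mono (ℕP.m≤m+n t t₀) r))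

  Sim-refl : ∀ u → Sim G h u u
  Sim-refl = Reach-refl (nV G)

  Sim-sym : ∀ {u v} → Sim G h u v → Sim G h v u
  Sim-sym = Reach-sym (nV G)

  Sim-trans : ∀ {u v w} → Sim G h u v → Sim G h v w → Sim G h u w
  Sim-trans r r′ = Reach-shorten _ (Reach-trans (nV G) (nV G) r r′)

  Sim⇒≡ : ∀ {u w} → Sim G h u w → h u ≡ h w
  Sim⇒≡ = Reach⇒≡ (nV G)

  Sim-edge : ∀ e {v w} → v ∈ inc G e → w ∈ inc G e → h v ≡ h w → Sim G h v w
  Sim-edge e {v} v∈e w∈e hv≡hw = Reach-shorten 1 (inj₂ (v , e , refl , v∈e , w∈e , hv≡hw))

module _ (G : Hypergraph) {k k′} {h : V G → Fin k} {h′ : V G → Fin k′}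
  (h≡⇒h′≡ : ∀ e {v w} → v ∈ inc G e → w ∈ inc G e → h v ≡ h w → h′ v ≡ h′ w) where

  Reach-transport : ∀ t {u w} → Reach G h t u w → Reach G h′ t u w
  Reach-transport zero    r        = r
  Reach-transport (suc t) (inj₁ r) = inj₁ (Reach-transport t r)
  Reach-transport (suc t) (inj₂ (v , e , r , v∈e , w∈e , hv≡hw)) =
    inj₂ (v , e , Reach-transport t r , v∈e , w∈e , h≡⇒h′≡ e v∈e w∈e hv≡hw)

  Sim-transport : ∀ {u w} → Sim G h u w → Sim G h′ u w
  Sim-transport = Reach-transport (nV G)

-- Quotients of decidable equivalence relations on Fin n

record Quotient {n : ℕ} (_∼_ : Rel (Fin n) 0ℓ) : Set where
  field
    #classes         : ℕ
    class            : Fin n → Fin #classes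
    class-surjective : Surjective class
    class≡⇒∼         : ∀ u v → class u ≡ class v → u ∼ v
    ∼⇒class≡         : ∀ u v → u ∼ v → class u ≡ class v

quotient : ∀ {n} {_∼_ : Rel (Fin n) 0ℓ} → IsDecEquivalence _∼_ → Quotient _∼_
quotient {zero} _ = record
  { #classes = 0 ; class = λ () ; class-surjective = λ () ; class≡⇒∼ = λ () ; ∼⇒class≡ = λ () }
quotient {suc n} {_∼_} ∼-isDecEquivalence with quotient ∼-on-suc | FinP.any? (λ v → zero ∼.≟ suc v)
  where
  module ∼ = IsDecEquivalence ∼-isDecEquivalence
  ∼-on-suc : IsDecEquivalence (λ u v → suc u ∼ suc v)
  ∼-on-suc = record
    { isEquivalence = record { refl = ∼.refl ; sym = ∼.sym ; trans = ∼.trans } ; _≟_ = λ u v → suc u ∼.≟ suc v }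
... | Q | yes (v₀ , 0∼v₀) = record
  { #classes = #classes ; class = class′ ; class-surjective = λ c → let u , eq = class-surjective c in suc u , eq
  ; class≡⇒∼ = ≡⇒∼ ; ∼⇒class≡ = ∼⇒≡ }
  where
  open Quotient Q
  module ∼ = IsDecEquivalence ∼-isDecEquivalence
  class′ : Fin (suc n) → Fin #classes
  class′ zero    = class v₀
  class′ (suc u) = class u
  ≡⇒∼ : ∀ u v → class′ u ≡ class′ v → u ∼ v
  ≡⇒∼ zero    zero    _  = ∼.refl
  ≡⇒∼ zero    (suc v) eq = ∼.trans 0∼v₀ (class≡⇒∼ v₀ v eq)
  ≡⇒∼ (suc u) zero    eq = ∼.trans (class≡⇒∼ u v₀ eq) (∼.sym 0∼v₀)
  ≡⇒∼ (suc u) (suc v) eq = class≡⇒∼ u v eq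
  ∼⇒≡ : ∀ u v → u ∼ v → class′ u ≡ class′ v
  ∼⇒≡ zero    zero    _   = refl
  ∼⇒≡ zero    (suc v) 0∼v = ∼⇒class≡ v₀ v (∼.trans (∼.sym 0∼v₀) 0∼v)
  ∼⇒≡ (suc u) zero    u∼0 = ∼⇒class≡ u v₀ (∼.trans u∼0 0∼v₀)
  ∼⇒≡ (suc u) (suc v) u∼v = ∼⇒class≡ u v u∼v
... | Q | no ∄v = record
  { #classes = suc #classes ; class = class′ ; class-surjective = surjective ; class≡⇒∼ = ≡⇒∼ ; ∼⇒class≡ = ∼⇒≡ }
  where
  open Quotient Q
  module ∼ = IsDecEquivalence ∼-isDecEquivalence
  class′ : Fin (suc n) → Fin (suc #classes)
  class′ zero    = zero
  class′ (suc u) = suc (class u)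
  surjective : Surjective class′
  surjective zero    = zero , refl
  surjective (suc c) = let u , eq = class-surjective c in suc u , cong suc eq
  ≡⇒∼ : ∀ u v → class′ u ≡ class′ v → u ∼ v
  ≡⇒∼ zero    zero    _  = ∼.refl
  ≡⇒∼ (suc u) (suc v) eq = class≡⇒∼ u v (FinP.suc-injective eq)
  ∼⇒≡ : ∀ u v → u ∼ v → class′ u ≡ class′ v
  ∼⇒≡ zero    zero    _   = refl
  ∼⇒≡ zero    (suc v) 0∼v = ⊥-elim (∄v (v , 0∼v))
  ∼⇒≡ (suc u) zero    u∼0 = ⊥-elim (∄v (u , ∼.sym u∼0))
  ∼⇒≡ (suc u) (suc v) u∼v = cong suc (∼⇒class≡ u v u∼v)

private variable
  n m l : ℕ

Injective-∘ : {f : Fin n → Fin m} {g : Fin m → Fin l} → Injective f → Injective g → Injective (g ∘ f)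
Injective-∘ f-inj g-inj u v eq = f-inj u v (g-inj _ _ eq)

Surjective-∘ : {f : Fin n → Fin m} {g : Fin m → Fin l} → Surjective f → Surjective g → Surjective (g ∘ f)
Surjective-∘ {g = g} f-surj g-surj w =
  let y , gy≡w = g-surj w ; x , fx≡y = f-surj y in x , trans (cong g fx≡y) gy≡w

Bijective-∘ : {f : Fin n → Fin m} {g : Fin m → Fin l} → Bijective f → Bijective g → Bijective (g ∘ f)
Bijective-∘ (f-inj , f-surj) (g-inj , g-surj) = Injective-∘ f-inj g-inj , Surjective-∘ f-surj g-surj

Injective-resp-≗ : {f g : Fin n → Fin m} → f ≗ g → Injective f → Injective g
Injective-resp-≗ f≗g f-inj u v eq = f-inj u v (trans (f≗g u) (trans eq (sym (f≗g v))))

Surjective-resp-≗ : {f g : Fin n → Fin m} → f ≗ g → Surjective f → Surjective g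
Surjective-resp-≗ f≗g f-surj w = let v , fv≡w = f-surj w in v , trans (sym (f≗g v)) fv≡w

Bijective-resp-≗ : {f g : Fin n → Fin m} → f ≗ g → Bijective f → Bijective g
Bijective-resp-≗ f≗g (f-inj , f-surj) = Injective-resp-≗ f≗g f-inj , Surjective-resp-≗ f≗g f-surj

module _ {f : Fin n → Fin m} (f-surj : Surjective f) where

  section : Fin m → Fin n
  section y = proj₁ (f-surj y)

  section-inverseʳ : ∀ y → f (section y) ≡ y
  section-inverseʳ y = proj₂ (f-surj y)

  section-injective : Injective section
  section-injective y y′ eq = trans (sym (section-inverseʳ y)) (trans (cong f eq) (section-inverseʳ y′))

  Surjective⇒≥ : m ≤ n
  Surjective⇒≥ = FinP.injective⇒≤ (λ {y} {y′} → section-injective y y′)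

module _ {f : Fin n → Fin m} (f-bij : Bijective f) where

  section-inverseˡ : ∀ x → section (proj₂ f-bij) (f x) ≡ x
  section-inverseˡ x = proj₁ f-bij _ _ (section-inverseʳ (proj₂ f-bij) (f x))

  section-bijective : Bijective (section (proj₂ f-bij))
  section-bijective = section-injective (proj₂ f-bij) , λ x → f x , section-inverseˡ x

  Bijective⇒≡ : n ≡ m
  Bijective⇒≡ = ℕP.≤-antisym (FinP.injective⇒≤ (λ {x} {x′} → proj₁ f-bij x x′)) (Surjective⇒≥ (proj₂ f-bij))

-- If f missed some w, punching w out of its codomain would inject Fin (suc n) into Fin n.
Injective⇒Surjective : (f : Fin n → Fin n) → Injective f → Surjective f
Injective⇒Surjective {zero}  f f-inj = λ ()
Injective⇒Surjective {suc n} f f-inj with surjective? f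
... | yes f-surj = f-surj
... | no ¬f-surj = ⊥-elim (ℕP.<-irrefl refl (FinP.injective⇒≤ punchOut-f-injective))
  where
  missed = FinP.¬∀⟶∃¬ (suc n) _ (λ w → FinP.any? (λ v → f v Fin.≟ w)) ¬f-surj
  w = proj₁ missed
  w≢f : ∀ x → w ≢ f x
  w≢f x eq = proj₂ missed (x , sym eq)
  punchOut-f-injective : ∀ {x y} → punchOut (w≢f x) ≡ punchOut (w≢f y) → x ≡ y
  punchOut-f-injective {x} {y} eq = f-inj x y (FinP.punchOut-injective (w≢f x) (w≢f y) eq)

Surjective⇒Injective : (f : Fin n → Fin n) → Surjective f → Injective f
Surjective⇒Injective f f-surj u v fu≡fv
  with x , refl ← Injective⇒Surjective (section f-surj) (section-injective f-surj) u
     | y , refl ← Injective⇒Surjective (section f-surj) (section-injective f-surj) v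
  = cong (section f-surj) (trans (sym (section-inverseʳ f-surj x)) (trans fu≡fv (section-inverseʳ f-surj y)))

module _ {G H : Hypergraph} {hV hV′ : V G → V H} {hE hE′ : E G → E H} (hV≗hV′ : hV ≗ hV′) (hE≗hE′ : hE ≗ hE′) where

  IsInHom-resp-≗ : IsInHom G H hV hE → IsInHom G H hV′ hE′
  IsInHom-resp-≗ inHom e v v∈e =
    subst (_∈ inc H (hE′ e)) (hV≗hV′ v) (subst (λ e′ → hV v ∈ inc H e′) (hE≗hE′ e) (inHom e v v∈e))

  IsHom-resp-≗ : IsHom G H hV hE → IsHom G H hV′ hE′
  IsHom-resp-≗ (inHom , onto) = IsInHom-resp-≗ inHom , λ e w w∈e′ →
    let v , v∈e , hv≡w = onto e w (subst (λ e′ → w ∈ inc H e′) (sym (hE≗hE′ e)) w∈e′)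
    in v , v∈e , trans (sym (hV≗hV′ v)) hv≡w

  IsIso-resp-≗ : IsIso G H hV hE → IsIso G H hV′ hE′
  IsIso-resp-≗ (hom , bijV , bijE) = IsHom-resp-≗ hom , Bijective-resp-≗ hV≗hV′ bijV , Bijective-resp-≗ hE≗hE′ bijE

  IsLoMe-resp-≗ : IsLoMe G H hV hE → IsLoMe G H hV′ hE′
  IsLoMe-resp-≗ (hom , merging , surjV , bijE) =
    IsHom-resp-≗ hom , merging′ , Surjective-resp-≗ hV≗hV′ surjV , Bijective-resp-≗ hE≗hE′ bijE
    where
    merging′ : ∀ u v → (hV′ u ≡ hV′ v → Sim G hV′ u v) × (Sim G hV′ u v → hV′ u ≡ hV′ v)
    merging′ u v =
      (λ eq → Sim-transport G (λ _ _ _ eq′ → trans (sym (hV≗hV′ _)) (trans eq′ (hV≗hV′ _)))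
                (proj₁ (merging u v) (trans (hV≗hV′ u) (trans eq (sym (hV≗hV′ v)))))) ,
      (λ sim → trans (sym (hV≗hV′ u)) (trans (proj₂ (merging u v)
                 (Sim-transport G (λ _ _ _ eq′ → trans (hV≗hV′ _) (trans eq′ (sym (hV≗hV′ _)))) sim)) (hV≗hV′ v)))

module _ {G H : Hypergraph} {hV : V G → V H} {hE : E G → E H} (lome : IsLoMe G H hV hE) where

  IsLoMe⇒IsHom : IsHom G H hV hE
  IsLoMe⇒IsHom = proj₁ lome

  IsLoMe⇒Surjective : Surjective hV
  IsLoMe⇒Surjective = proj₁ (proj₂ (proj₂ lome))

  IsLoMe⇒Bijectiveₑ : Bijective hE
  IsLoMe⇒Bijectiveₑ = proj₂ (proj₂ (proj₂ lome))

IsLocInj-resp-≗ : ∀ {G H} {hV hV′ : V G → V H} → hV ≗ hV′ → IsLocInj G H hV → IsLocInj G H hV′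
IsLocInj-resp-≗ hV≗hV′ locInj e u v u∈e v∈e eq =
  locInj e u v u∈e v∈e (trans (hV≗hV′ u) (trans eq (sym (hV≗hV′ v))))

module _ {G H K : Hypergraph} {f : V G → V H} {fE : E G → E H} {g : V H → V K} {gE : E H → E K} where

  IsInHom-∘ : IsInHom G H f fE → IsInHom H K g gE → IsInHom G K (g ∘ f) (gE ∘ fE)
  IsInHom-∘ f-inHom g-inHom e v v∈e = g-inHom (fE e) (f v) (f-inHom e v v∈e)

  IsHom-∘ : IsHom G H f fE → IsHom H K g gE → IsHom G K (g ∘ f) (gE ∘ fE)
  IsHom-∘ (f-inHom , f-onto) (g-inHom , g-onto) = IsInHom-∘ f-inHom g-inHom , λ e w w∈e →
    let y , y∈e , gy≡w = g-onto (fE e) w w∈e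
        x , x∈e , fx≡y = f-onto e y y∈e
    in x , x∈e , trans (cong g fx≡y) gy≡w

IsLocInj-∘ : ∀ {G H K} {f : V G → V H} {fE : E G → E H} {g : V H → V K} →
  IsInHom G H f fE → IsLocInj G H f → IsLocInj H K g → IsLocInj G K (g ∘ f)
IsLocInj-∘ {f = f} {fE} f-inHom f-locInj g-locInj e u v u∈e v∈e eq =
  f-locInj e u v u∈e v∈e (g-locInj (fE e) (f u) (f v) (f-inHom e u u∈e) (f-inHom e v v∈e) eq)

IsIso⇒IsLocInj : ∀ {G H} {f : V G → V H} {fE} → IsIso G H f fE → IsLocInj G H f
IsIso⇒IsLocInj (_ , (f-inj , _) , _) e u v _ _ = f-inj u v

module _ {G H : Hypergraph} {f : V G → V H} {fE : E G → E H} (iso : IsIso G H f fE) where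

  private
    bijV = proj₁ (proj₂ iso)
    bijE = proj₂ (proj₂ iso)

  vertex⁻¹ : V H → V G
  vertex⁻¹ = section (proj₂ bijV)

  edge⁻¹ : E H → E G
  edge⁻¹ = section (proj₂ bijE)

  vertex⁻¹-inverseˡ : ∀ x → vertex⁻¹ (f x) ≡ x
  vertex⁻¹-inverseˡ = section-inverseˡ bijV

  edge⁻¹-inverseˡ : ∀ e → edge⁻¹ (fE e) ≡ e
  edge⁻¹-inverseˡ = section-inverseˡ bijE

  IsIso-inverse : IsIso H G vertex⁻¹ edge⁻¹
  IsIso-inverse = (inHom , onto) , section-bijective bijV , section-bijective bijE
    where
    f-onto = proj₂ (proj₁ iso)
    fE-section : ∀ e′ → fE (edge⁻¹ e′) ≡ e′
    fE-section = section-inverseʳ (proj₂ bijE)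
    inHom : IsInHom H G vertex⁻¹ edge⁻¹
    inHom e′ w w∈e′ =
      let v , v∈e , fv≡w = f-onto (edge⁻¹ e′) w (subst (λ e → w ∈ inc H e) (sym (fE-section e′)) w∈e′)
      in subst (_∈ inc G (edge⁻¹ e′)) (trans (sym (vertex⁻¹-inverseˡ v)) (cong vertex⁻¹ fv≡w)) v∈e
    onto : ∀ e′ v → v ∈ inc G (edge⁻¹ e′) → ∃ λ w → w ∈ inc H e′ × vertex⁻¹ w ≡ v
    onto e′ v v∈e = f v , subst (λ e → f v ∈ inc H e) (fE-section e′) (proj₁ (proj₁ iso) (edge⁻¹ e′) v v∈e) ,
                    vertex⁻¹-inverseˡ v

id-IsIso : ∀ G → IsIso G G (λ v → v) (λ e → e)
id-IsIso G = ((λ _ _ v∈e → v∈e) , (λ _ w w∈e → w , w∈e , refl)) , id-bijective , id-bijective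
  where
  id-bijective : ∀ {n} → Bijective {n} (λ x → x)
  id-bijective = (λ _ _ eq → eq) , (λ y → y , refl)

id-IsLoMe : ∀ G → IsLoMe G G (λ v → v) (λ e → e)
id-IsLoMe G = proj₁ (id-IsIso G) ,
  (λ u v → (λ { refl → Sim-refl G (λ x → x) u }) , Sim⇒≡ G (λ x → x)) ,
  proj₂ (proj₁ (proj₂ (id-IsIso G))) , proj₂ (proj₂ (id-IsIso G))

IsLoMe-∘-IsIso : ∀ {G H K} {σ : V G → V H} {σE : E G → E H} {β : V H → V K} {βE : E H → E K} →
  IsLoMe G H σ σE → IsIso H K β βE → IsLoMe G K (β ∘ σ) (βE ∘ σE)
IsLoMe-∘-IsIso {G} {H} {K} {σ = σ} {β = β} (σ-hom , σ-merging , σ-surj , σE-bij) (β-hom , (β-inj , β-surj) , βE-bij) =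
  IsHom-∘ {G} {H} {K} σ-hom β-hom ,
  (λ u v → (λ eq → Sim-transport G (λ _ _ _ → cong β) (proj₁ (σ-merging u v) (β-inj _ _ eq))) ,
           (λ sim → cong β (proj₂ (σ-merging u v) (Sim-transport G (λ _ _ _ → β-inj _ _) sim)))) ,
  Surjective-∘ σ-surj β-surj , Bijective-∘ σE-bij βE-bij

IsLoMe-sizes : ∀ {G H} {σ : V G → V H} {σE : E G → E H} → IsLoMe G H σ σE → nV H ≤ nV G × nE G ≡ nE H
IsLoMe-sizes (_ , _ , σ-surj , σE-bij) = Surjective⇒≥ σ-surj , Bijective⇒≡ σE-bij

IsLoMe⇒IsIso : ∀ {G H} {σ : V G → V H} {σE : E G → E H} → nV G ≡ nV H → IsLoMe G H σ σE → IsIso G H σ σE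
IsLoMe⇒IsIso {σ = σ} refl (hom , _ , σ-surj , σE-bij) = hom , (Surjective⇒Injective σ σ-surj , σ-surj) , σE-bij

-- Factorisations into a locally merging and a locally injective homomorphism

Maps : Hypergraph → Hypergraph → Set
Maps G H = (V G → V H) × (E G → E H)

record IsFactorisation {G X H : Hypergraph} (φ : V G → V H) (φE : E G → E H)
  (σ : V G → V X) (σE : E G → E X) (τ : V X → V H) (τE : E X → E H) : Set where
  field
    σ-IsLoMe   : IsLoMe G X σ σE
    τ-IsInHom  : IsInHom X H τ τE
    τ-IsLocInj : IsLocInj X H τ
    τ∘σ≗φ      : τ ∘ σ ≗ φ
    τE∘σE≗φE   : τE ∘ σE ≗ φE

Factorises : ∀ {G X H} → Maps G H → Maps G X × Maps X H → Set
Factorises {G} {X} {H} (φ , φE) ((σ , σE) , (τ , τE)) = IsFactorisation {G} {X} {H} φ φE σ σE τ τE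

≗-cancel-surjective : ∀ {n m} {A : Set} {s : Fin n → Fin m} {g h : Fin m → A} →
  Surjective s → g ∘ s ≗ h ∘ s → g ≗ h
≗-cancel-surjective {g = g} {h} s-surj gs≗hs y =
  let x , sx≡y = s-surj y in trans (cong g (sym sx≡y)) (trans (gs≗hs x) (cong h sx≡y))

module Induced {G X Y : Hypergraph} {σ₁ : V G → V X} {σ₁E : E G → E X} {σ₂ : V G → V Y} {σ₂E : E G → E Y}
  (σ₁-hom : IsHom G X σ₁ σ₁E) (σ₁-surj : Surjective σ₁) (σ₁E-bij : Bijective σ₁E)
  (σ₂-hom : IsHom G Y σ₂ σ₂E) (σ₂-surj : Surjective σ₂) (σ₂E-bij : Bijective σ₂E)
  (σ₁≡⇒σ₂≡ : ∀ u v → σ₁ u ≡ σ₁ v → σ₂ u ≡ σ₂ v) (σ₂≡⇒σ₁≡ : ∀ u v → σ₂ u ≡ σ₂ v → σ₁ u ≡ σ₁ v)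
  where

  private
    s₁ = section σ₁-surj
    s₁E = section (proj₂ σ₁E-bij)

  induced : V X → V Y
  induced = σ₂ ∘ s₁

  inducedE : E X → E Y
  inducedE = σ₂E ∘ s₁E

  induced-∘ : induced ∘ σ₁ ≗ σ₂
  induced-∘ u = σ₁≡⇒σ₂≡ _ _ (section-inverseʳ σ₁-surj (σ₁ u))

  inducedE-∘ : inducedE ∘ σ₁E ≗ σ₂E
  inducedE-∘ e = cong σ₂E (section-inverseˡ σ₁E-bij e)

  induced-IsIso : IsIso X Y induced inducedE
  induced-IsIso = (inHom , onto) , (injective , surjective) , (injectiveE , surjectiveE)
    where
    injective : Injective induced
    injective x y eq = trans (sym (section-inverseʳ σ₁-surj x)) (trans (σ₂≡⇒σ₁≡ _ _ eq) (section-inverseʳ σ₁-surj y))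
    surjective : Surjective induced
    surjective y = let u , σ₂u≡y = σ₂-surj y in σ₁ u , trans (induced-∘ u) σ₂u≡y
    injectiveE : Injective inducedE
    injectiveE e e′ eq = trans (sym (section-inverseʳ (proj₂ σ₁E-bij) e))
      (trans (cong σ₁E (proj₁ σ₂E-bij _ _ eq)) (section-inverseʳ (proj₂ σ₁E-bij) e′))
    surjectiveE : Surjective inducedE
    surjectiveE e = let e₀ , σ₂Ee₀≡e = proj₂ σ₂E-bij e in σ₁E e₀ , trans (inducedE-∘ e₀) σ₂Ee₀≡e
    σ₁E-s₁E : ∀ e′ → σ₁E (s₁E e′) ≡ e′
    σ₁E-s₁E = section-inverseʳ (proj₂ σ₁E-bij)
    inHom : IsInHom X Y induced inducedE
    inHom e′ x x∈e′ =
      let v , v∈e , σ₁v≡x = proj₂ σ₁-hom (s₁E e′) x (subst (λ e → x ∈ inc X e) (sym (σ₁E-s₁E e′)) x∈e′)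
      in subst (_∈ inc Y (σ₂E (s₁E e′))) (trans (sym (induced-∘ v)) (cong induced σ₁v≡x))
           (proj₁ σ₂-hom (s₁E e′) v v∈e)
    onto : ∀ e′ y → y ∈ inc Y (inducedE e′) → ∃ λ x → x ∈ inc X e′ × induced x ≡ y
    onto e′ y y∈e =
      let v , v∈e , σ₂v≡y = proj₂ σ₂-hom (s₁E e′) y y∈e
      in σ₁ v , subst (λ e → σ₁ v ∈ inc X e) (σ₁E-s₁E e′) (proj₁ σ₁-hom (s₁E e′) v v∈e) ,
         trans (induced-∘ v) σ₂v≡y

module _ {G X H : Hypergraph} {φ : V G → V H} {φE : E G → E H}
  {σ : V G → V X} {σE : E G → E X} {τ : V X → V H} {τE : E X → E H}
  (fact : IsFactorisation {G} {X} {H} φ φE σ σE τ τE) where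

  open IsFactorisation fact
    using (σ-IsLoMe; τ-IsInHom; τ-IsLocInj; τ∘σ≗φ; τE∘σE≗φE)

  -- The kernel of σ is ∼_φ: one inclusion because τ ∘ σ ≗ φ, the other because τ is locally injective.
  σ≡⇒Sim : ∀ u v → σ u ≡ σ v → Sim G φ u v
  σ≡⇒Sim u v σu≡σv =
    Sim-transport G (λ _ {v} {w} _ _ σv≡σw → trans (sym (τ∘σ≗φ v)) (trans (cong τ σv≡σw) (τ∘σ≗φ w)))
    (proj₁ (proj₁ (proj₂ σ-IsLoMe) u v) σu≡σv)

  Sim⇒σ≡ : ∀ u v → Sim G φ u v → σ u ≡ σ v
  Sim⇒σ≡ u v sim = proj₂ (proj₁ (proj₂ σ-IsLoMe) u v) (Sim-transport G φ≡⇒σ≡ sim)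
    where
    σ-IsInHom = proj₁ (IsLoMe⇒IsHom {G} {X} σ-IsLoMe)
    φ≡⇒σ≡ : ∀ e {v w} → v ∈ inc G e → w ∈ inc G e → φ v ≡ φ w → σ v ≡ σ w
    φ≡⇒σ≡ e {v} {w} v∈e w∈e φv≡φw = τ-IsLocInj (σE e) (σ v) (σ w) (σ-IsInHom e v v∈e) (σ-IsInHom e w w∈e)
      (trans (τ∘σ≗φ v) (trans φv≡φw (sym (τ∘σ≗φ w))))

  IsFactorisation⇒IsInHom : IsInHom G H φ φE
  IsFactorisation⇒IsInHom = IsInHom-resp-≗ {G} {H} τ∘σ≗φ τE∘σE≗φE
    (IsInHom-∘ {G} {X} {H} (proj₁ (IsLoMe⇒IsHom {G} {X} σ-IsLoMe)) τ-IsInHom)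

  IsFactorisation-transport : ∀ {Y} {β : V X → V Y} {βE : E X → E Y} (iso : IsIso X Y β βE) →
    IsFactorisation {G} {Y} {H} φ φE (β ∘ σ) (βE ∘ σE) (τ ∘ vertex⁻¹ {X} {Y} iso) (τE ∘ edge⁻¹ {X} {Y} iso)
  IsFactorisation-transport {Y} iso = record
    { σ-IsLoMe   = IsLoMe-∘-IsIso {G} {X} {Y} σ-IsLoMe iso
    ; τ-IsInHom  = IsInHom-∘ {Y} {X} {H} inverse-IsInHom τ-IsInHom
    ; τ-IsLocInj = IsLocInj-∘ {Y} {X} {H} inverse-IsInHom (IsIso⇒IsLocInj {Y} {X} inverse) τ-IsLocInj
    ; τ∘σ≗φ      = λ u → trans (cong τ (vertex⁻¹-inverseˡ {X} {Y} iso (σ u))) (τ∘σ≗φ u)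
    ; τE∘σE≗φE   = λ e → trans (cong τE (edge⁻¹-inverseˡ {X} {Y} iso (σE e))) (τE∘σE≗φE e)
    }
    where
    inverse = IsIso-inverse {X} {Y} iso
    inverse-IsInHom = proj₁ (proj₁ inverse)

IsFactorisation-resp-≗ : ∀ {G X H} {φ : V G → V H} {φE : E G → E H}
  {σ σ′ : V G → V X} {σE σE′ : E G → E X} {τ τ′ : V X → V H} {τE τE′ : E X → E H} →
  σ ≗ σ′ → σE ≗ σE′ → τ ≗ τ′ → τE ≗ τE′ →
  IsFactorisation {G} {X} {H} φ φE σ σE τ τE → IsFactorisation {G} {X} {H} φ φE σ′ σE′ τ′ τE′
IsFactorisation-resp-≗ {G} {X} {H} {σ = σ} {σE = σE} {τ′ = τ′} {τE′ = τE′} σ≗ σE≗ τ≗ τE≗ fact = record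
  { σ-IsLoMe   = IsLoMe-resp-≗ {G} {X} σ≗ σE≗ σ-IsLoMe
  ; τ-IsInHom  = IsInHom-resp-≗ {X} {H} τ≗ τE≗ τ-IsInHom
  ; τ-IsLocInj = IsLocInj-resp-≗ {X} {H} τ≗ τ-IsLocInj
  ; τ∘σ≗φ      = λ u → trans (cong τ′ (sym (σ≗ u))) (trans (sym (τ≗ (σ u))) (τ∘σ≗φ u))
  ; τE∘σE≗φE   = λ e → trans (cong τE′ (sym (σE≗ e))) (trans (sym (τE≗ (σE e))) (τE∘σE≗φE e))
  }
  where open IsFactorisation fact

module Comparison {G X Y H : Hypergraph} {φ : V G → V H} {φE : E G → E H}
  {σ₁ : V G → V X} {σ₁E : E G → E X} {τ₁ : V X → V H} {τ₁E : E X → E H}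
  {σ₂ : V G → V Y} {σ₂E : E G → E Y} {τ₂ : V Y → V H} {τ₂E : E Y → E H}
  (fact₁ : IsFactorisation {G} {X} {H} φ φE σ₁ σ₁E τ₁ τ₁E)
  (fact₂ : IsFactorisation {G} {Y} {H} φ φE σ₂ σ₂E τ₂ τ₂E) =
  Induced {G} {X} {Y}
    (IsLoMe⇒IsHom {G} {X} (IsFactorisation.σ-IsLoMe fact₁)) (IsLoMe⇒Surjective {G} {X} (IsFactorisation.σ-IsLoMe fact₁))
    (IsLoMe⇒Bijectiveₑ {G} {X} (IsFactorisation.σ-IsLoMe fact₁))
    (IsLoMe⇒IsHom {G} {Y} (IsFactorisation.σ-IsLoMe fact₂)) (IsLoMe⇒Surjective {G} {Y} (IsFactorisation.σ-IsLoMe fact₂))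
    (IsLoMe⇒Bijectiveₑ {G} {Y} (IsFactorisation.σ-IsLoMe fact₂))
    (λ u v → Sim⇒σ≡ fact₂ u v ∘ σ≡⇒Sim fact₁ u v) (λ u v → Sim⇒σ≡ fact₁ u v ∘ σ≡⇒Sim fact₂ u v)

toSubset : ∀ {n} {P : Pred (Fin n) 0ℓ} → Decidable P → Subset n
toSubset P? = Vec.tabulate (does ∘ P?)

∈-toSubset⁺ : ∀ {n} {P : Pred (Fin n) 0ℓ} (P? : Decidable P) {x} → P x → x ∈ toSubset P?
∈-toSubset⁺ P? {x} px = VecP.lookup⇒[]= x _ (trans (VecP.lookup∘tabulate (does ∘ P?) x) (does-yes (P? x)))
  where
  does-yes : (d : Dec _) → does d ≡ true
  does-yes (yes _)  = refl
  does-yes (no ¬px) = ⊥-elim (¬px px)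

∈-toSubset⁻ : ∀ {n} {P : Pred (Fin n) 0ℓ} (P? : Decidable P) {x} → x ∈ toSubset P? → P x
∈-toSubset⁻ P? {x} x∈ with P? x | VecP.lookup∘tabulate (does ∘ P?) x | VecP.[]=⇒lookup x∈
... | yes px | _ | _ = px
... | no _ | does≡false | does≡true with () ← trans (sym does≡false) does≡true

module _ (G H : Hypergraph) (G-connected : Connected G) {φ : V G → V H} {φE : E G → E H}
  (φ-inHom : IsInHom G H φ φE) where

  private
    Sim-isDecEquivalence : IsDecEquivalence (Sim G φ)
    Sim-isDecEquivalence = record
      { isEquivalence = record { refl = Sim-refl G φ _ ; sym = Sim-sym G φ ; trans = Sim-trans G φ }
      ; _≟_ = reach? G φ (nV G) }

    open Quotient (quotient Sim-isDecEquivalence)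

    ImageMember : E G → Fin #classes → Set
    ImageMember e c = ∃ λ v → v ∈ inc G e × class v ≡ c

    imageMember? : ∀ e → Decidable (ImageMember e)
    imageMember? e c = FinP.any? (λ v → (v ∈? inc G e) ×-dec (class v Fin.≟ c))

    image : Hypergraph
    image = hypergraph #classes (nE G) (λ e → toSubset (imageMember? e))
      (λ e → let v , v∈e = inc-nonempty G e in class v , ∈-toSubset⁺ (imageMember? e) (v , v∈e , refl))

    class-IsHom : IsHom G image class (λ e → e)
    class-IsHom = (λ e v v∈e → ∈-toSubset⁺ (imageMember? e) (v , v∈e , refl)) ,
                  (λ e c c∈e → ∈-toSubset⁻ (imageMember? e) c∈e)

    class-IsLoMe : IsLoMe G image class (λ e → e)
    class-IsLoMe = class-IsHom ,
      (λ u v → (λ eq → Sim-transport G (λ e v∈e w∈e φv≡φw → ∼⇒class≡ _ _ (Sim-edge G φ e v∈e w∈e φv≡φw))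
                         (class≡⇒∼ u v eq)) ,
               Sim⇒≡ G class) ,
      class-surjective , (λ _ _ eq → eq) , (λ e → e , refl)

    descend : V image → V H
    descend c = φ (section class-surjective c)

    descend-∘-class : descend ∘ class ≗ φ
    descend-∘-class u = Sim⇒≡ G φ (class≡⇒∼ _ _ (section-inverseʳ class-surjective (class u)))

    descend-IsInHom : IsInHom image H descend φE
    descend-IsInHom e c c∈e = let v , v∈e , class-v≡c = ∈-toSubset⁻ (imageMember? e) c∈e in
        subst (_∈ inc H (φE e)) (trans (sym (descend-∘-class v)) (cong descend class-v≡c)) (φ-inHom e v v∈e)
    descend-IsLocInj : IsLocInj image H descend
    descend-IsLocInj e c d c∈e d∈e descend-c≡descend-d
      with v , v∈e , refl ← ∈-toSubset⁻ (imageMember? e) c∈e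
         | w , w∈e , refl ← ∈-toSubset⁻ (imageMember? e) d∈e
      = ∼⇒class≡ v w (Sim-edge G φ e v∈e w∈e
          (trans (sym (descend-∘-class v)) (trans descend-c≡descend-d (descend-∘-class w))))

    image-connected : Connected image
    image-connected = node (proj₁ G-connected) , λ x y →
      subst₂ (Star (IAdj image)) (node∘lift x) (node∘lift y) (gmap node adjacent (proj₂ G-connected (lift x) (lift y)))
      where
      node : Node G → Node image
      node (inj₁ v) = inj₁ (class v)
      node (inj₂ e) = inj₂ e
      lift : Node image → Node G
      lift (inj₁ c) = inj₁ (section class-surjective c)
      lift (inj₂ e) = inj₂ e
      node∘lift : ∀ x → node (lift x) ≡ x
      node∘lift (inj₁ c) = cong inj₁ (section-inverseʳ class-surjective c)
      node∘lift (inj₂ e) = refl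
      adjacent : ∀ {x y} → IAdj G x y → IAdj image (node x) (node y)
      adjacent {inj₁ v} {inj₂ e} v∈e = proj₁ class-IsHom e v v∈e
      adjacent {inj₂ e} {inj₁ v} v∈e = proj₁ class-IsHom e v v∈e

  factorisation-exists : ∃ λ X → Connected X × ∃ λ b → Factorises {G} {X} {H} (φ , φE) b
  factorisation-exists = image , image-connected , ((class , λ e → e) , (descend , φE)) , record
    { σ-IsLoMe = class-IsLoMe ; τ-IsInHom = descend-IsInHom ; τ-IsLocInj = descend-IsLocInj
    ; τ∘σ≗φ = descend-∘-class ; τE∘σE≗φE = λ _ → refl }

maps-decSetoid : Hypergraph → Hypergraph → DecSetoid 0ℓ 0ℓ
maps-decSetoid G H = ×-decSetoid (≗-decSetoid (nV G) (nV H)) (≗-decSetoid (nE G) (nE H))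

maps : ∀ G H → List (Maps G H)
maps G H = cartesianProduct (funs (nV G) (nV H)) (funs (nE G) (nE H))

maps-enumerates : ∀ G H → Enumerates (maps-decSetoid G H) (maps G H)
maps-enumerates G H = cartesianProduct-enumerates (funs-enumerates (nV G) (nV H)) (funs-enumerates (nE G) (nE H))

countPairs≡count : ∀ G H P P? → countPairs G H P P? ≡ count (λ p → P? (proj₁ p) (proj₂ p)) (maps G H)
countPairs≡count G H P P? = length-filter≡count (λ p → P? (proj₁ p) (proj₂ p)) (maps G H)

module _ (G H : Hypergraph) {P : (V G → V H) → (E G → E H) → Set} (P? : ∀ hV hE → Dec (P hV hE)) where

  countPairs≢0⇒∃ : countPairs G H P P? ≢ 0 → ∃ λ hV → ∃ λ hE → P hV hE
  countPairs≢0⇒∃ count≢0 =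
    let (hV , hE) , _ , p = count≢0⇒∃ (λ q → P? (proj₁ q) (proj₂ q)) (maps G H)
                              (count≢0 ∘ trans (countPairs≡count G H P P?))
    in hV , hE , p

  ∃⇒countPairs≢0 : (∀ {hV hV′ hE hE′} → hV ≗ hV′ → hE ≗ hE′ → P hV hE → P hV′ hE′) →
    ∀ hV hE → P hV hE → countPairs G H P P? ≢ 0
  ∃⇒countPairs≢0 P-resp hV hE p countPairs≡0 =
    let (hV′ , hE′) , ∈maps , (hV′≗hV , hE′≗hE) = count≢0⇒∃ _ (maps G H)
          (λ count≡0 → ℕP.1+n≢0 (trans (sym (maps-enumerates G H .occurs-once (hV , hE))) count≡0))
    in ∃⇒count≢0 (λ q → P? (proj₁ q) (proj₂ q)) ∈maps (P-resp (sym ∘ hV′≗hV) (sym ∘ hE′≗hE) p)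
         (trans (sym (countPairs≡count G H P P?)) countPairs≡0)

module _ (G X H : Hypergraph) where

  private
    module MapsGH = DecSetoid (maps-decSetoid G H)

  factorisations : List (Maps G X × Maps X H)
  factorisations = cartesianProduct (maps G X) (maps X H)

  factorisations-enumerates : Enumerates (×-decSetoid (maps-decSetoid G X) (maps-decSetoid X H)) factorisations
  factorisations-enumerates =
    cartesianProduct-enumerates (maps-enumerates G X) (maps-enumerates X H)

  composite : Maps G X × Maps X H → Maps G H
  composite ((σ , σE) , (τ , τE)) = τ ∘ σ , τE ∘ σE

  IsLoMeLoInj : Maps G X × Maps X H → Set
  IsLoMeLoInj ((σ , σE) , (τ , τE)) = IsLoMe G X σ σE × (IsInHom X H τ τE × IsLocInj X H τ)

  isLoMeLoInj? : ∀ b → Dec (IsLoMeLoInj b)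
  isLoMeLoInj? ((σ , σE) , (τ , τE)) = isLoMe? G X σ σE ×-dec (isInHom? X H τ τE ×-dec isLocInj? X H τ)

  Factorises⇔ : ∀ φ b → (IsLoMeLoInj b × composite b MapsGH.≈ φ → Factorises {G} {X} {H} φ b)
                       × (Factorises {G} {X} {H} φ b → IsLoMeLoInj b × composite b MapsGH.≈ φ)
  Factorises⇔ φ b =
    (λ ((lome , inHom , locInj) , (τσ≗φ , τEσE≗φE)) → record
      { σ-IsLoMe = lome ; τ-IsInHom = inHom ; τ-IsLocInj = locInj ; τ∘σ≗φ = τσ≗φ ; τE∘σE≗φE = τEσE≗φE }) ,
    (λ fact → (σ-IsLoMe fact , τ-IsInHom fact , τ-IsLocInj fact) , (τ∘σ≗φ fact , τE∘σE≗φE fact))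
    where open IsFactorisation

  factorises? : ∀ φ b → Dec (Factorises {G} {X} {H} φ b)
  factorises? φ b =
    map′ (proj₁ (Factorises⇔ φ b)) (proj₂ (Factorises⇔ φ b)) (isLoMeLoInj? b ×-dec (composite b MapsGH.≟ φ))

  #factorisations : Maps G H → ℕ
  #factorisations φ = count (factorises? φ) factorisations

  LoMeHom*LoInjInHom≡∑#factorisations : LoMeHom G X * LoInjInHom X H ≡ ∑ #factorisations (maps G H)
  LoMeHom*LoInjInHom≡∑#factorisations = begin
    LoMeHom G X * LoInjInHom X H
      ≡⟨ cong₂ _*_ (countPairs≡count G X _ (isLoMe? G X)) (countPairs≡count X H _ _) ⟩
    count (λ σ → isLoMe? G X (proj₁ σ) (proj₂ σ)) (maps G X)
      * count (λ τ → isInHom? X H (proj₁ τ) (proj₂ τ) ×-dec isLocInj? X H (proj₁ τ)) (maps X H)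
      ≡⟨ sym (count-cartesianProduct _ _ (maps G X) (maps X H)) ⟩
    count isLoMeLoInj? factorisations
      ≡⟨ count-fibres isLoMeLoInj? (λ b φ → factorises? φ b) factorisations (maps G H) unique-composite
           (λ b φ → proj₁ ∘ proj₂ (Factorises⇔ φ b)) ⟩
    ∑ #factorisations (maps G H) ∎
    where
    open ≡-Reasoning
    unique-composite : ∀ b → IsLoMeLoInj b → count (λ φ → factorises? φ b) (maps G H) ≡ 1
    unique-composite b valid = trans
      (count-cong (λ φ → factorises? φ b) (MapsGH._≟ composite b) (maps G H)
        (λ φ _ fact → MapsGH.sym (proj₂ (proj₂ (Factorises⇔ φ b) fact)))
        (λ φ _ φ≈composite → proj₁ (Factorises⇔ φ b) (valid , MapsGH.sym φ≈composite)))
      (maps-enumerates G H .occurs-once (composite b))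

  module _ {φ : Maps G H} {b₀ : Maps G X × Maps X H} (fact₀ : Factorises {G} {X} {H} φ b₀) where

    private
      module MapsXX = DecSetoid (maps-decSetoid X X)
      module Factorisations = DecSetoid (×-decSetoid (maps-decSetoid G X) (maps-decSetoid X H))
      σ₀-lome = IsFactorisation.σ-IsLoMe fact₀
      s₀  = section (IsLoMe⇒Surjective {G} {X} σ₀-lome)
      s₀E = section (proj₂ (IsLoMe⇒Bijectiveₑ {G} {X} σ₀-lome))

    -- Aut X acts simply transitively on the factorisations of φ through X; the orbit map is inverted
    -- by sending a factorisation (σ , τ) to the comparison isomorphism σ ∘ σ₀⁻¹.
    comparison : Maps G X × Maps X H → Maps X X
    comparison ((σ , σE) , _) = σ ∘ s₀ , σE ∘ s₀E

    comparison-cong : ∀ {b b′} → b Factorisations.≈ b′ → comparison b MapsXX.≈ comparison b′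
    comparison-cong ((σ≗ , σE≗) , _) = σ≗ ∘ s₀ , σE≗ ∘ s₀E

    comparison-IsIso : ∀ b → Factorises {G} {X} {H} φ b → IsIso X X (proj₁ (comparison b)) (proj₂ (comparison b))
    comparison-IsIso b fact = Comparison.induced-IsIso fact₀ fact

    comparison-onto : ∀ β → IsIso X X (proj₁ β) (proj₂ β) →
      ∃ λ b → Factorises {G} {X} {H} φ b × comparison b MapsXX.≈ β
    comparison-onto (β , βE) iso =
      ((β ∘ proj₁ (proj₁ b₀) , βE ∘ proj₂ (proj₁ b₀)) ,
       (proj₁ (proj₂ b₀) ∘ vertex⁻¹ {X} {X} iso , proj₂ (proj₂ b₀) ∘ edge⁻¹ {X} {X} iso)) ,
      IsFactorisation-transport fact₀ iso ,
      (cong β ∘ section-inverseʳ (IsLoMe⇒Surjective {G} {X} σ₀-lome) ,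
       cong βE ∘ section-inverseʳ (proj₂ (IsLoMe⇒Bijectiveₑ {G} {X} σ₀-lome)))

    comparison-injective : ∀ b b′ → Factorises {G} {X} {H} φ b → Factorises {G} {X} {H} φ b′ →
      comparison b MapsXX.≈ comparison b′ → b Factorisations.≈ b′
    comparison-injective ((σ , σE) , (τ , τE)) ((σ′ , σE′) , (τ′ , τE′)) fact fact′ (≗V , ≗E) =
      (σ≗σ′ , σE≗σE′) , (τ≗τ′ , τE≗τE′)
      where
      module C = Comparison fact₀ fact
      module C′ = Comparison fact₀ fact′
      σ≗σ′ : σ ≗ σ′
      σ≗σ′ u = trans (sym (C.induced-∘ u)) (trans (≗V (proj₁ (proj₁ b₀) u)) (C′.induced-∘ u))
      σE≗σE′ : σE ≗ σE′
      σE≗σE′ e = trans (sym (C.inducedE-∘ e)) (trans (≗E (proj₂ (proj₁ b₀) e)) (C′.inducedE-∘ e))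
      τ≗τ′ : τ ≗ τ′
      τ≗τ′ = ≗-cancel-surjective (IsLoMe⇒Surjective {G} {X} (IsFactorisation.σ-IsLoMe fact)) λ u →
        trans (IsFactorisation.τ∘σ≗φ fact u) (trans (sym (IsFactorisation.τ∘σ≗φ fact′ u)) (cong τ′ (sym (σ≗σ′ u))))
      τE≗τE′ : τE ≗ τE′
      τE≗τE′ = ≗-cancel-surjective (proj₂ (IsLoMe⇒Bijectiveₑ {G} {X} (IsFactorisation.σ-IsLoMe fact))) λ e →
        trans (IsFactorisation.τE∘σE≗φE fact e)
              (trans (sym (IsFactorisation.τE∘σE≗φE fact′ e)) (cong τE′ (sym (σE≗σE′ e))))

    #factorisations≡Aut : #factorisations φ ≡ Aut X
    #factorisations≡Aut = sym (trans (countPairs≡count X X _ (isIso? X X))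
      (count-bijection (maps-enumerates X X) factorisations-enumerates
        (λ β → isIso? X X (proj₁ β) (proj₂ β)) (factorises? φ) comparison
        (λ (≗V , ≗E) → IsIso-resp-≗ {X} {X} ≗V ≗E)
        (λ ((σ≗ , σE≗) , (τ≗ , τE≗)) → IsFactorisation-resp-≗ σ≗ σE≗ τ≗ τE≗)
        comparison-cong comparison-IsIso comparison-onto comparison-injective))

Aut≢0 : ∀ G → Aut G ≢ 0
Aut≢0 G = ∃⇒countPairs≢0 G G (isIso? G G) (IsIso-resp-≗ {G} {G}) _ _ (id-IsIso G)

LoMeHom-refl≢0 : ∀ G → LoMeHom G G ≢ 0
LoMeHom-refl≢0 G = ∃⇒countPairs≢0 G G (isLoMe? G G) (IsLoMe-resp-≗ {G} {G}) _ _ (id-IsLoMe G)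

LoMeHom≢0⇒IsLoMe : ∀ G H → LoMeHom G H ≢ 0 → ∃ λ σ → ∃ λ σE → IsLoMe G H σ σE
LoMeHom≢0⇒IsLoMe G H = countPairs≢0⇒∃ G H (isLoMe? G H)

‖_‖ : Hypergraph → ℕ
‖ G ‖ = nV G + nE G

module _ (R : RepSystem) where

  open RepSystem R

  _≟ᵢ_ : DecidableEquality Idx
  _≟ᵢ_ = ProductP.≡-dec ℕ._≟_ (ProductP.≡-dec ℕ._≟_ Fin._≟_)

  private
    block : ℕ → ℕ → List Idx
    block n m = map (λ i → n , m , i) (allFin (length (reps n m)))

    count-block : ∀ n m a → count (_≟ᵢ a) (block n m) ≡ 𝟙[ n ℕ.≟ proj₁ a ] * 𝟙[ m ℕ.≟ proj₁ (proj₂ a) ]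
    count-block n m (n₀ , m₀ , i₀) =
      trans (∑-map (λ b → 𝟙[ b ≟ᵢ (n₀ , m₀ , i₀) ]) (λ i → n , m , i) (allFin _)) (by-cases (n ℕ.≟ n₀) (m ℕ.≟ m₀))
      where
      by-cases : (n≟n₀ : Dec (n ≡ n₀)) (m≟m₀ : Dec (m ≡ m₀)) →
        count (λ i → (n , m , i) ≟ᵢ (n₀ , m₀ , i₀)) (allFin _) ≡ 𝟙[ n≟n₀ ] * 𝟙[ m≟m₀ ]
      by-cases (yes refl) (yes refl) = trans
        (count-cong (λ i → (n , m , i) ≟ᵢ (n₀ , m₀ , i₀)) (Fin._≟ i₀) (allFin _)
          (λ { _ _ refl → refl }) (λ { _ _ refl → refl }))
        (allFin-enumerates _ .occurs-once i₀)
      by-cases (yes refl) (no m≢m₀) =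
        count-none (λ i → (n , m , i) ≟ᵢ (n₀ , m₀ , i₀)) (allFin _) (λ { _ refl → m≢m₀ refl })
      by-cases (no n≢n₀)  _         =
        count-none (λ i → (n , m , i) ≟ᵢ (n₀ , m₀ , i₀)) (allFin _) (λ { _ refl → n≢n₀ refl })

  idxUpTo-count : ∀ B a → count (_≟ᵢ a) (idxUpTo B) ≡ 𝟙[ size a ≤? B ]
  idxUpTo-count B a@(n₀ , m₀ , _) = begin
    count (_≟ᵢ a) (idxUpTo B)
      ≡⟨ ∑-concatMap (λ b → 𝟙[ b ≟ᵢ a ]) (λ n → concatMap (block n) (upTo (suc (B ∸ n)))) (upTo (suc B)) ⟩
    ∑ (λ n → count (_≟ᵢ a) (concatMap (block n) (upTo (suc (B ∸ n))))) (upTo (suc B))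
      ≡⟨ ∑-cong (upTo (suc B)) (λ n → trans (∑-concatMap (λ b → 𝟙[ b ≟ᵢ a ]) (block n) (upTo (suc (B ∸ n))))
                                           (count-row n)) ⟩
    ∑ (λ n → 𝟙[ n ℕ.≟ n₀ ] * 𝟙[ m₀ <? suc (B ∸ n) ]) (upTo (suc B))
      ≡⟨ ∑-δ ℕ._≟_ (λ n → 𝟙[ m₀ <? suc (B ∸ n) ]) (upTo (suc B)) n₀ ⟩
    count (ℕ._≟ n₀) (upTo (suc B)) * 𝟙[ m₀ <? suc (B ∸ n₀) ]
      ≡⟨ cong (_* 𝟙[ m₀ <? suc (B ∸ n₀) ]) (upTo-count (suc B) n₀) ⟩
    𝟙[ n₀ <? suc B ] * 𝟙[ m₀ <? suc (B ∸ n₀) ]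
      ≡⟨ sym (𝟙-× (n₀ <? suc B) (m₀ <? suc (B ∸ n₀))) ⟩
    𝟙[ (n₀ <? suc B) ×-dec (m₀ <? suc (B ∸ n₀)) ]
      ≡⟨ 𝟙-cong _ (size a ≤? B) bounds⇒size≤ size≤⇒bounds ⟩
    𝟙[ size a ≤? B ] ∎
    where
    open ≡-Reasoning
    count-row : ∀ n →
      ∑ (λ m → count (_≟ᵢ a) (block n m)) (upTo (suc (B ∸ n))) ≡ 𝟙[ n ℕ.≟ n₀ ] * 𝟙[ m₀ <? suc (B ∸ n) ]
    count-row n = begin
      ∑ (λ m → count (_≟ᵢ a) (block n m)) (upTo (suc (B ∸ n)))
        ≡⟨ ∑-cong (upTo (suc (B ∸ n))) (λ m → trans (count-block n m a) (ℕP.*-comm 𝟙[ n ℕ.≟ n₀ ] _)) ⟩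
      ∑ (λ m → 𝟙[ m ℕ.≟ m₀ ] * 𝟙[ n ℕ.≟ n₀ ]) (upTo (suc (B ∸ n)))
        ≡⟨ ∑-*ʳ 𝟙[ n ℕ.≟ n₀ ] (λ m → 𝟙[ m ℕ.≟ m₀ ]) (upTo (suc (B ∸ n))) ⟩
      count (ℕ._≟ m₀) (upTo (suc (B ∸ n))) * 𝟙[ n ℕ.≟ n₀ ]
        ≡⟨ cong (_* 𝟙[ n ℕ.≟ n₀ ]) (upTo-count (suc (B ∸ n)) m₀) ⟩
      𝟙[ m₀ <? suc (B ∸ n) ] * 𝟙[ n ℕ.≟ n₀ ]
        ≡⟨ ℕP.*-comm _ 𝟙[ n ℕ.≟ n₀ ] ⟩
      𝟙[ n ℕ.≟ n₀ ] * 𝟙[ m₀ <? suc (B ∸ n) ] ∎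
    bounds⇒size≤ : n₀ < suc B × m₀ < suc (B ∸ n₀) → n₀ + m₀ ≤ B
    bounds⇒size≤ (s≤s n₀≤B , s≤s m₀≤B∸n₀) = subst (_≤ B) (ℕP.+-comm m₀ n₀) (ℕP.m≤o∸n⇒m+n≤o m₀ n₀≤B m₀≤B∸n₀)
    size≤⇒bounds : n₀ + m₀ ≤ B → n₀ < suc B × m₀ < suc (B ∸ n₀)
    size≤⇒bounds size≤B = s≤s (ℕP.m+n≤o⇒m≤o n₀ size≤B) ,
                           s≤s (ℕP.m+n≤o⇒m≤o∸n m₀ (subst (_≤ B) (ℕP.+-comm n₀ m₀) size≤B))

  size≡ : ∀ a → size a ≡ ‖ rep a ‖
  size≡ (n , m , i) = sym (cong₂ _+_ (rep-nV n m i) (rep-nE n m i))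

  IsLoMe⇒size≤ : ∀ G a {σ σE} → IsLoMe G (rep a) σ σE → size a ≤ ‖ G ‖
  IsLoMe⇒size≤ G a lome with IsLoMe-sizes {G} {rep a} lome
  ... | nV≤ , nE≡ = subst (_≤ ‖ G ‖) (sym (size≡ a)) (ℕP.+-mono-≤ nV≤ (ℕP.≤-reflexive (sym nE≡)))

  LoMeHom-beyond : ∀ G a → ‖ G ‖ < size a → LoMeHom G (rep a) ≡ 0
  LoMeHom-beyond G a size>G with LoMeHom G (rep a) ℕ.≟ 0
  ... | yes ≡0 = ≡0
  ... | no ≢0 = let _ , _ , lome = LoMeHom≢0⇒IsLoMe G (rep a) ≢0 in
    ⊥-elim (ℕP.<⇒≱ size>G (IsLoMe⇒size≤ G a lome))

  LoMeHom-triangular : ∀ i j → LoMeHom (rep i) (rep j) ≢ 0 → i ≡ j ⊎ size j < size i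
  LoMeHom-triangular i j ≢0 with LoMeHom≢0⇒IsLoMe (rep i) (rep j) ≢0
  ... | σ , σE , lome with IsLoMe-sizes {rep i} {rep j} lome
  ...   | nV≤ , nE≡ with ℕP.m≤n⇒m<n∨m≡n nV≤
  ...     | inj₁ nV< = inj₂ (subst₂ _<_ (sym (size≡ j)) (sym (size≡ i)) (ℕP.+-mono-<-≤ nV< (ℕP.≤-reflexive (sym nE≡))))
  ...     | inj₂ nV≡ = inj₁ (rep-distinct i j (σ , σE , IsLoMe⇒IsIso {rep i} {rep j} (sym nV≡) lome))

  module _ (G H : Hypergraph) (G-connected : Connected G) where

    FactorsThrough : Idx → Maps G H → Set
    FactorsThrough a φ = #factorisations G (rep a) H φ ≢ 0

    factorsThrough? : ∀ a φ → Dec (FactorsThrough a φ)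
    factorsThrough? a φ = ¬? (#factorisations G (rep a) H φ ℕ.≟ 0)

    FactorsThrough⇒∃ : ∀ {a φ} → FactorsThrough a φ → ∃ λ b → Factorises {G} {rep a} {H} φ b
    FactorsThrough⇒∃ {a} {φ} ≢0 =
      let b , _ , fact = count≢0⇒∃ (factorises? G (rep a) H φ) (factorisations G (rep a) H) ≢0 in b , fact

    ∃⇒FactorsThrough : ∀ {a φ} b → Factorises {G} {rep a} {H} φ b → FactorsThrough a φ
    ∃⇒FactorsThrough {a} b fact ≡0 = Aut≢0 (rep a) (trans (sym (#factorisations≡Aut G (rep a) H fact)) ≡0)

    FactorsThrough-unique : ∀ {a a′ φ} → FactorsThrough a φ → FactorsThrough a′ φ → a ≡ a′
    FactorsThrough-unique {a} {a′} through through′ =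
      let b , fact = FactorsThrough⇒∃ through ; b′ , fact′ = FactorsThrough⇒∃ through′
          open Comparison fact fact′
      in rep-distinct a a′ (induced , inducedE , induced-IsIso)

    FactorsThrough-exists : ∀ {φ} → IsInHom G H (proj₁ φ) (proj₂ φ) → ∃ λ a → FactorsThrough a φ
    FactorsThrough-exists φ-inHom with factorisation-exists G H G-connected φ-inHom
    ... | X , X-connected , b , fact with rep-complete X X-connected
    ...   | a , β , βE , iso = a , ∃⇒FactorsThrough _ (IsFactorisation-transport fact iso)

    FactorsThrough⇒IsInHom : ∀ {a φ} → FactorsThrough a φ → IsInHom G H (proj₁ φ) (proj₂ φ)
    FactorsThrough⇒IsInHom through = IsFactorisation⇒IsInHom (proj₂ (FactorsThrough⇒∃ through))

    FactorsThrough⇒size≤ : ∀ {a φ} → FactorsThrough a φ → size a ≤ ‖ G ‖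
    FactorsThrough⇒size≤ {a} through =
      IsLoMe⇒size≤ G a (IsFactorisation.σ-IsLoMe (proj₂ (FactorsThrough⇒∃ through)))

    #inHomsThrough : Idx → ℕ
    #inHomsThrough a = count (factorsThrough? a) (maps G H)

    ∑𝟙[FactorsThrough]≡1 : ∀ {φ} → IsInHom G H (proj₁ φ) (proj₂ φ) →
      ∑ (λ a → 𝟙[ factorsThrough? a φ ]) (idxUpTo ‖ G ‖) ≡ 1
    ∑𝟙[FactorsThrough]≡1 {φ} inHom = let a₀ , through₀ = FactorsThrough-exists {φ} inHom in begin
      ∑ (λ a → 𝟙[ factorsThrough? a φ ]) (idxUpTo ‖ G ‖)
        ≡⟨ count-cong {P = λ a → FactorsThrough a φ} {Q = _≡ a₀}
          (λ a → factorsThrough? a φ) (_≟ᵢ a₀) (idxUpTo ‖ G ‖)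
          (λ a _ through → FactorsThrough-unique {a} {a₀} {φ} through through₀)
          (λ { a _ refl → through₀ }) ⟩
      count (_≟ᵢ a₀) (idxUpTo ‖ G ‖)
        ≡⟨ idxUpTo-count ‖ G ‖ a₀ ⟩
      𝟙[ size a₀ ≤? ‖ G ‖ ]
        ≡⟨ 𝟙-yes (size a₀ ≤? ‖ G ‖) (FactorsThrough⇒size≤ {a₀} {φ} through₀) ⟩
      1 ∎
      where
      open ≡-Reasoning

    𝟙-IsInHom≡∑ : ∀ φ →
      𝟙[ isInHom? G H (proj₁ φ) (proj₂ φ) ] ≡ ∑ (λ a → 𝟙[ factorsThrough? a φ ]) (idxUpTo ‖ G ‖)
    𝟙-IsInHom≡∑ φ = 𝟙-by-cases (isInHom? G H (proj₁ φ) (proj₂ φ)) ∑𝟙[FactorsThrough]≡1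
      (λ ¬inHom → count-none (λ a → factorsThrough? a φ) (idxUpTo ‖ G ‖)
                    (λ a → ¬inHom ∘ FactorsThrough⇒IsInHom {a} {φ}))

    InHom≡∑#inHomsThrough : InHom G H ≡ ∑ #inHomsThrough (idxUpTo ‖ G ‖)
    InHom≡∑#inHomsThrough = begin
      InHom G H
        ≡⟨ countPairs≡count G H (IsInHom G H) (isInHom? G H) ⟩
      count (λ φ → isInHom? G H (proj₁ φ) (proj₂ φ)) (maps G H)
        ≡⟨ ∑-cong (maps G H) 𝟙-IsInHom≡∑ ⟩
      ∑ (λ φ → ∑ (λ a → 𝟙[ factorsThrough? a φ ]) (idxUpTo ‖ G ‖)) (maps G H)
        ≡⟨ ∑-comm (λ φ a → 𝟙[ factorsThrough? a φ ]) (maps G H) (idxUpTo ‖ G ‖) ⟩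
      ∑ #inHomsThrough (idxUpTo ‖ G ‖) ∎
      where
      open ≡-Reasoning

    #factorisations≡Aut*𝟙 : ∀ a φ → #factorisations G (rep a) H φ ≡ Aut (rep a) * 𝟙[ factorsThrough? a φ ]
    #factorisations≡Aut*𝟙 a φ = *𝟙-by-cases (factorsThrough? a φ)
      (λ through → #factorisations≡Aut G (rep a) H (proj₂ (FactorsThrough⇒∃ {a} {φ} through)))
      (decidable-stable (#factorisations G (rep a) H φ ℕ.≟ 0))

    LoMeHom*LoInjInHom≡Aut*#inHomsThrough : ∀ a →
      LoMeHom G (rep a) * LoInjInHom (rep a) H ≡ Aut (rep a) * #inHomsThrough a
    LoMeHom*LoInjInHom≡Aut*#inHomsThrough a = begin
      LoMeHom G (rep a) * LoInjInHom (rep a) H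
        ≡⟨ LoMeHom*LoInjInHom≡∑#factorisations G (rep a) H ⟩
      ∑ (#factorisations G (rep a) H) (maps G H)
        ≡⟨ ∑-cong (maps G H) (#factorisations≡Aut*𝟙 a) ⟩
      ∑ (λ φ → Aut (rep a) * 𝟙[ factorsThrough? a φ ]) (maps G H)
        ≡⟨ ∑-*ˡ (Aut (rep a)) (λ φ → 𝟙[ factorsThrough? a φ ]) (maps G H) ⟩
      Aut (rep a) * #inHomsThrough a ∎
      where open ≡-Reasoning

  module _ (G H : Hypergraph) where

    term : Idx → ℚ
    term a = toℚ (LoMeHom G (rep a)) *ℚ inv (Aut (rep a)) *ℚ toℚ (LoInjInHom (rep a) H)

    term-beyond : ∀ a → ‖ G ‖ < size a → term a ≡ 0ℚ
    term-beyond a size>G = begin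
      toℚ (LoMeHom G (rep a)) *ℚ inv (Aut (rep a)) *ℚ toℚ (LoInjInHom (rep a) H)
        ≡⟨ cong (λ n → toℚ n *ℚ inv (Aut (rep a)) *ℚ toℚ (LoInjInHom (rep a) H)) (LoMeHom-beyond G a size>G) ⟩
      0ℚ *ℚ inv (Aut (rep a)) *ℚ toℚ (LoInjInHom (rep a) H)
        ≡⟨ trans (cong (_*ℚ toℚ (LoInjInHom (rep a) H)) (ℚP.*-zeroˡ (inv (Aut (rep a)))))
                 (ℚP.*-zeroˡ (toℚ (LoInjInHom (rep a) H))) ⟩
      0ℚ ∎
      where open ≡-Reasoning

    InHom≡sumUpTo : Connected G → toℚ (InHom G H) ≡ sumUpTo ‖ G ‖ term
    InHom≡sumUpTo G-connected = begin
      toℚ (InHom G H)                       ≡⟨ cong toℚ (InHom≡∑#inHomsThrough G H G-connected) ⟩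
      toℚ (ℕΣ.∑ #inHoms (idxUpTo ‖ G ‖))    ≡⟨ toℚ-∑ #inHoms (idxUpTo ‖ G ‖) ⟩
      ℚΣ.∑ (toℚ ∘ #inHoms) (idxUpTo ‖ G ‖)  ≡⟨ ℚΣ.∑-cong (idxUpTo ‖ G ‖) (sym ∘ term≡) ⟩
      ℚΣ.∑ term (idxUpTo ‖ G ‖)             ≡⟨ sym (sumℚ-map term (idxUpTo ‖ G ‖)) ⟩
      sumUpTo ‖ G ‖ term ∎
      where
      open ≡-Reasoning
      #inHoms = #inHomsThrough G H G-connected
      term≡ : ∀ a → term a ≡ toℚ (#inHoms a)
      term≡ a = toℚ-quotient (LoMeHom G (rep a)) (LoInjInHom (rep a) H) (Aut (rep a)) (#inHoms a) (Aut≢0 (rep a))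
        (LoMeHom*LoInjInHom≡Aut*#inHomsThrough G H G-connected a)

  idxUpTo-countℚ : ∀ s i → ℚΣ.count (_≟ᵢ i) (idxUpTo s) ≡ ℚΣ.𝟙[ size i ≤? s ]
  idxUpTo-countℚ s i = trans (sym (toℚ-count (_≟ᵢ i) (idxUpTo s)))
    (trans (cong toℚ (idxUpTo-count s i)) (toℚ-𝟙 (size i ≤? s)))

  LoMeMat-lower : ∀ i j → i ≢ j → ¬ size j < size i → LoMeMat i j ≡ 0ℚ
  LoMeMat-lower i j i≢j j≮i = cong toℚ (decidable-stable (LoMeHom (rep i) (rep j) ℕ.≟ 0)
    (λ ≢0 → [ i≢j , j≮i ]′ (LoMeHom-triangular i j ≢0)))

  LoMeMat*inv≡1 : ∀ i → LoMeMat i i *ℚ inv (LoMeHom (rep i) (rep i)) ≡ 1ℚ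
  LoMeMat*inv≡1 i = toℚ*inv≡1 (LoMeHom (rep i) (rep i)) (LoMeHom-refl≢0 (rep i))

  open LowerTriangularInverse _≟ᵢ_ size idxUpTo idxUpTo-countℚ LoMeMat (λ i → inv (LoMeHom (rep i) (rep i)))
    LoMeMat-lower LoMeMat*inv≡1 public using (δ; N; N-lower; M*N≡δ; N*M≡δ)

  IsIdentity-δ : (A : Idx → Idx → ℚ) → (∀ i k → A i k ≡ δ i k) → IsIdentity A
  IsIdentity-δ A A≡δ i k =
    (λ i≡k → trans (A≡δ i k) (ℚΣ.𝟙-yes (i ≟ᵢ k) i≡k)) , (λ i≢k → trans (A≡δ i k) (ℚΣ.𝟙-no (i ≟ᵢ k) i≢k))

  module _ {_≼_ : Idx → Idx → Set} (≡⇒≼ : ∀ {i j} → i ≡ j → i ≼ j) (<⇒≼ : ∀ a b → size a < size b → a ≼ b)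
    where

    LoMeMat-lowerTriangular : LowerTriangular _≼_ LoMeMat
    LoMeMat-lowerTriangular i j j⋠i = LoMeMat-lower i j (λ i≡j → j⋠i (≡⇒≼ (sym i≡j))) (λ j<i → j⋠i (<⇒≼ j i j<i))

    N-lowerTriangular : LowerTriangular _≼_ N
    N-lowerTriangular i j j⋠i = N-lower i j (j⋠i ∘ ≡⇒≼) (ℕP.≮⇒≥ (λ j<i → j⋠i (<⇒≼ j i j<i)))

lemma4 : (R : RepSystem) → let open RepSystem R in
    -- the counting identity, with finitely many non-zero terms
    (∀ (G H : Hypergraph) → Connected G →
      ∃ λ B →
        (∀ a → B < size a →
          toℚ (LoMeHom G (rep a)) *ℚ inv (Aut (rep a)) *ℚ toℚ (LoInjInHom (rep a) H) ≡ 0ℚ)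
        × toℚ (InHom G H) ≡ sumUpTo B (λ a →
          toℚ (LoMeHom G (rep a)) *ℚ inv (Aut (rep a)) *ℚ toℚ (LoInjInHom (rep a) H)))
    ×
    -- for every total order on the representatives refining |V| + |E|,
    -- the matrix LoMeHom is lower triangular and has a (lower triangular) inverse
    (∀ (_≼_ : Idx → Idx → Set) → IsTotalOrder _≡_ _≼_ →
      (∀ a b → size a < size b → a ≼ b) →
      LowerTriangular _≼_ LoMeMat
      × (∃ λ (N : Idx → Idx → ℚ) → LowerTriangular _≼_ N
          × IsIdentity (λ i k → sumUpTo (size i) (λ j → LoMeMat i j *ℚ N j k))
          × IsIdentity (λ i k → sumUpTo (size i) (λ j → N i j *ℚ LoMeMat j k))))
lemma4 R =
  (λ G H G-connected → ‖ G ‖ , term-beyond R G H , InHom≡sumUpTo R G H G-connected) ,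
  λ _≼_ ≼-isTotalOrder <⇒≼ →
    LoMeMat-lowerTriangular R (IsTotalOrder.reflexive ≼-isTotalOrder) <⇒≼ ,
    N R ,
    N-lowerTriangular R (IsTotalOrder.reflexive ≼-isTotalOrder) <⇒≼ ,
    IsIdentity-δ R _ (λ i k → trans (sumℚ-map _ (idxUpTo (size i))) (M*N≡δ R i k)) ,
    IsIdentity-δ R _ (λ i k → trans (sumℚ-map _ (idxUpTo (size i))) (N*M≡δ R i k))
  where open RepSystem R
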